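{- Let $T$ be a graph and let $u_1,\dots,u_k$ be distinct vertices of $T$, for some $k\geq 1$. For each $i=1,\dots,k$ let $G_i$ be a rooted graph with root $r_i$, and set $$Q_i=PG_i-x\,P(G_i-r_i),\qquad R_i=P(G_i-r_i).$$ Then for any signature $(a_1,\dots,a_k)$ of positive integers, $$P\,T(u_1\!=\!r_1)G_1^{(a_1)}\cdots(u_k\!=\!r_k)G_k^{(a_k)}=\sum_{I\subseteq\{1,\dots,k\}} P\Bigl(T-\textstyle\sum_{i\in I}u_i\Bigr)\prod_{j\in I}a_j\prod_{l\in I}Q_l\prod_{m=1}^k R_m^{\,a_m-|\{m\}\cap I|}.$$
   Context: For a graph $H$, $PH$ (or $P(H)$) denotes the characteristic polynomial of the adjacency matrix of $H$ in the variable $x$. For a rooted graph $G$ with root $r$ and integer $a\geq1$, $G^{(a)}$ is the graph obtained from $a$ vertex-disjoint copies of $G$ by identifying all their roots into one vertex, again called the root $r$. For vertex-disjoint graphs $T,H_1,\dots,H_k$, distinct vertices $u_1,\dots,u_k$ of $T$ and vertices $v_i$ of $H_i$, the multiple coalescence $T(u_1\!=\!v_1)H_1\cdots(u_k\!=\!v_k)H_k$ is the graph obtained from the disjoint union $T\cup H_1\cup\cdots\cup H_k$ by identifying $u_i$ with $v_i$ for each $i$. The notation $T-\sum_{i\in I}u_i$ denotes the graph obtained from $T$ by deleting the vertices $u_i$, $i\in I$, together with their incident edges (for $I=\emptyset$ it is $T$ itself). $G-r$ denotes deletion of vertex $r$. -}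

module Defs where

open import Data.Nat using (ℕ; zero; suc; _∸_; _≤_)
open import Data.Integer as ℤ using (ℤ; +_; _-_; _^_)
open import Data.Fin using (Fin; zero; suc; punchIn; splitAt; _≟_)
open import Data.Fin.Subset using (Subset; inside; outside)
open import Data.Bool using (Bool; true; false; _∨_; _∧_; not; if_then_else_)
open import Data.Sum using (inj₁; inj₂)
open import Data.Maybe using (Maybe; just; nothing)
open import Data.List as List using (List; length; filterᵇ; allFin)
open import Data.Vec using ([]; _∷_; lookup)
open import Relation.Nullary.Decidable using (⌊_⌋)
open import Relation.Binary.PropositionalEquality using (_≡_)

Adj : ℕ → Set
Adj n = Fin n → Fin n → Bool

record Graph : Set where
  constructor mkGraph
  field
    size : ℕ
    adj  : Adj size
open Graph public

IsSimple : ∀ {n} → Adj n → Set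
IsSimple {n} A = (∀ i j → A i j ≡ A j i) × (∀ i → A i i ≡ false)
  where open import Data.Product using (_×_)

sumFin : (n : ℕ) → (Fin n → ℤ) → ℤ
sumFin zero    f = + 0
sumFin (suc n) f = f zero ℤ.+ sumFin n (λ i → f (suc i))

prodFin : (n : ℕ) → (Fin n → ℤ) → ℤ
prodFin zero    f = + 1
prodFin (suc n) f = f zero ℤ.* prodFin n (λ i → f (suc i))

sumSubsets : (k : ℕ) → (Subset k → ℤ) → ℤ
sumSubsets zero    f = f []
sumSubsets (suc k) f = sumSubsets k (λ s → f (outside ∷ s)) ℤ.+ sumSubsets k (λ s → f (inside ∷ s))

det : (n : ℕ) → (Fin n → Fin n → ℤ) → ℤ
det zero    M = + 1
det (suc n) M = sumFin (suc n) λ j →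
  ((ℤ.- + 1) ^ Data.Fin.toℕ j) ℤ.* (M zero j ℤ.* det n (λ a b → M (suc a) (punchIn j b)))

charPoly : Graph → ℤ → ℤ
charPoly G x = det (size G) λ i j →
  (if ⌊ i ≟ j ⌋ then x else + 0) - (if adj G i j then + 1 else + 0)

induced : (G : Graph) → List (Fin (size G)) → Graph
induced G L = mkGraph (length L) (λ i j → adj G (List.lookup L i) (List.lookup L j))

deleteVerts : (G : Graph) → (Fin (size G) → Bool) → Graph
deleteVerts G del = induced G (filterᵇ (λ v → not (del v)) (allFin (size G)))

deleteVertex : (G : Graph) → Fin (size G) → Graph
deleteVertex G r = deleteVerts G (λ v → ⌊ v ≟ r ⌋)

anyFin : (k : ℕ) → (Fin k → Bool) → Bool
anyFin zero    p = false
anyFin (suc k) p = p zero ∨ anyFin k (λ i → p (suc i))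

deleteImage : ∀ {k} (T : Graph) → (Fin k → Fin (size T)) → Subset k → Graph
deleteImage {k} T u I = deleteVerts T (λ v → anyFin k (λ i → lookup I i ∧ ⌊ u i ≟ v ⌋))

-- Coalescence T(u = r)G, with G on Fin (suc m).
-- Vertices of the result (Fin (n + m)): first the n vertices of T
-- (same order), then the m non-root vertices of G (order of G with r removed).

gImage : ∀ {n m} → Fin n → Fin (suc m) → Fin (Data.Nat._+_ n m) → Maybe (Fin (suc m))
gImage {n} u r x with splitAt n x
... | inj₁ t = if ⌊ t ≟ u ⌋ then just r else nothing
... | inj₂ g = just (punchIn r g)

tImage : ∀ {n m} → Fin (Data.Nat._+_ n m) → Maybe (Fin n)
tImage {n} x with splitAt n x
... | inj₁ t = just t
... | inj₂ g = nothing

coalesce : ∀ {n m} → Adj n → Fin n → Adj (suc m) → Fin (suc m) → Adj (Data.Nat._+_ n m)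
coalesce {n} {m} T u G r x y = tPart (tImage {n} {m} x) (tImage {n} {m} y) ∨ gPart (gImage u r x) (gImage u r y)
  where
  tPart : Maybe (Fin n) → Maybe (Fin n) → Bool
  tPart (just a) (just b) = T a b
  tPart _ _ = false
  gPart : Maybe (Fin (suc m)) → Maybe (Fin (suc m)) → Bool
  gPart (just a) (just b) = G a b
  gPart _ _ = false

-- G^(a): a copies of G glued at the root.  Root is vertex zero.
-- powSize m a = number of non-root vertices of G^(a)

powSize : ℕ → ℕ → ℕ
powSize m zero    = zero
powSize m (suc a) = Data.Nat._+_ (powSize m a) m

rootedPower : ∀ {m} → Adj (suc m) → Fin (suc m) → (a : ℕ) → Adj (suc (powSize m a))
rootedPower G r zero    = λ _ _ → false
rootedPower G r (suc a) = coalesce (rootedPower G r a) zero G r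

-- Multiple coalescence T(u_1 = r_1)H_1 ... (u_k = r_k)H_k,
-- H_i = G_i^(a_i) with root r_i (vertex zero of G_i^(a_i)).
-- Performed sequentially; vertices of T keep their positions.

multiCoalesce : (k : ℕ) (T : Graph) (u : Fin k → Fin (size T))
  (m : Fin k → ℕ) (G : (i : Fin k) → Adj (suc (m i))) (r : (i : Fin k) → Fin (suc (m i)))
  (a : Fin k → ℕ) → Graph
multiCoalesce zero    T u m G r a = T
multiCoalesce (suc k) T u m G r a =
  multiCoalesce k
    (mkGraph _ (coalesce (adj T) (u zero) (rootedPower (G zero) (r zero) (a zero)) zero))
    (λ i → u (suc i) Data.Fin.↑ˡ _)
    (λ i → m (suc i)) (λ i → G (suc i)) (λ i → r (suc i)) (λ i → a (suc i))

{-# OPTIONS --safe #-}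
-- Coalescing G₀^(a₀) into T at u₀ and then deleting some of the other u_i
-- gives the same graph as first deleting them from T, so Schwenk's formula
--   P(H(u=r)G) = PH·P(G−r) + P(H−u)·(PG − x·P(G−r))
-- splits the term of each subset I of {1, …, k} in the induction hypothesis into the terms of
-- I and {0} ∪ I. The factors for G₀^(a₀) come from P(G^(a) − r) = R^a and, by Schwenk's formula
-- and induction on a, P(G^(a)) = x·R^a + a·Q·R^(a−1).
-- Schwenk's formula is proved for det as a first-row Laplace expansion: with u moved to the
-- front, xI − A becomes [[x, r_S, r_R], [c_S, A, 0], [c_R, 0, D]], and linearity in the first
-- row and column reduces it to block triangular determinants. Invariance of det under
-- simultaneous permutation of rows and columns is built from adjacent row and column swaps.
module Submission where

open import Defs
open import Data.Nat as ℕ using (ℕ; zero; suc; _≤_; _∸_; z≤n; s≤s)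
import Data.Nat.Properties as ℕP
open import Data.Integer using (ℤ; +_; _-_; _*_; _^_; _+_; -_)
import Data.Integer.Properties as ℤP
open import Data.Integer.Tactic.RingSolver using (solve-∀)
open import Algebra.Properties.AbelianGroup ℤP.+-0-abelianGroup using (∙-cancelˡ)
open import Data.Fin using (Fin; zero; suc; punchIn; toℕ; inject₁; _↑ˡ_; _↑ʳ_; splitAt; cast; _≟_)
import Data.Fin.Properties as FP
open import Data.Fin.Subset using (Subset; inside; outside)
open import Data.Vec using ([]; _∷_; lookup)
open import Data.Bool as Bool using (Bool; true; false; _∨_; _∧_; not; if_then_else_)
open import Data.Bool.Properties using (∨-identityʳ; ∧-zeroʳ)
open import Data.Maybe using (just; nothing)
open import Data.Unit using (tt)
open import Data.List as List using (List; []; _∷_; _++_; map; filterᵇ; tabulate; allFin; length)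
import Data.List.Properties as LP
open import Data.List.Relation.Unary.All as All using (All; []; _∷_)
import Data.List.Relation.Unary.All.Properties as AllP
open import Data.List.Relation.Unary.AllPairs using ([]; _∷_)
open import Data.List.Relation.Unary.Unique.Propositional using (Unique)
import Data.List.Relation.Unary.Unique.Propositional.Properties as UniqueP
open import Data.List.Relation.Unary.Any using (index)
open import Data.List.Relation.Unary.Any.Properties using (lookup-index)
open import Data.List.Membership.Propositional using (_∈_)
open import Data.List.Membership.Propositional.Properties using (∈-filter⁺; ∈-allFin)
open import Data.Sum using ([_,_]′)
open import Data.Product using (Σ; _,_; proj₂)
open import Data.Empty using (⊥-elim)
open import Relation.Nullary using (yes; no; ¬_)
open import Relation.Nullary.Decidable using (⌊_⌋; T?)
open import Relation.Binary.PropositionalEquality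
open import Function using (_∘_; id)
open import Function.Definitions using (Injective)

-- Laplace expansion

Mat : ℕ → Set
Mat n = Fin n → Fin n → ℤ

sign : ∀ {n} → Fin n → ℤ
sign j = (- + 1) ^ toℕ j

minor : ∀ {n} → Mat (suc n) → Fin (suc n) → Mat n
minor M j a b = M (suc a) (punchIn j b)

sign-suc : ∀ {n} (j : Fin n) → sign (suc j) ≡ - sign j
sign-suc j = ℤP.-1*i≡-i (sign j)

sign-inject₁ : ∀ {n} (i : Fin n) → sign (inject₁ i) ≡ sign i
sign-inject₁ i = cong ((- + 1) ^_) (FP.toℕ-inject₁ i)

sign-↑ˡ : ∀ {p} (i : Fin p) q → sign (i ↑ˡ q) ≡ sign i
sign-↑ˡ i q = cong ((- + 1) ^_) (FP.toℕ-↑ˡ i q)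

sumFin-cong : ∀ n {f g : Fin n → ℤ} → (∀ i → f i ≡ g i) → sumFin n f ≡ sumFin n g
sumFin-cong zero    f≗g = refl
sumFin-cong (suc n) f≗g = cong₂ _+_ (f≗g zero) (sumFin-cong n (f≗g ∘ suc))

sumFin-+ : ∀ n (f g : Fin n → ℤ) → sumFin n (λ i → f i + g i) ≡ sumFin n f + sumFin n g
sumFin-+ zero    f g = refl
sumFin-+ (suc n) f g = trans (cong (_+_ (f zero + g zero)) (sumFin-+ n (f ∘ suc) (g ∘ suc)))
                             (interchange (f zero) (g zero) _ _)
  where
  interchange : ∀ a b c d → a + b + (c + d) ≡ a + c + (b + d)
  interchange = solve-∀

sumFin-*ˡ : ∀ n (c : ℤ) (f : Fin n → ℤ) → c * sumFin n f ≡ sumFin n (λ i → c * f i)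
sumFin-*ˡ zero    c f = ℤP.*-zeroʳ c
sumFin-*ˡ (suc n) c f = trans (ℤP.*-distribˡ-+ c (f zero) _) (cong (_+_ (c * f zero)) (sumFin-*ˡ n c (f ∘ suc)))

sumFin-*ʳ : ∀ n (c : ℤ) (f : Fin n → ℤ) → sumFin n f * c ≡ sumFin n (λ i → f i * c)
sumFin-*ʳ n c f = trans (ℤP.*-comm _ c)
  (trans (sumFin-*ˡ n c f) (sumFin-cong n (λ i → ℤP.*-comm c (f i))))

sumFin-neg : ∀ n (f : Fin n → ℤ) → sumFin n (λ i → - f i) ≡ - sumFin n f
sumFin-neg zero    f = refl
sumFin-neg (suc n) f = trans (cong (_+_ (- f zero)) (sumFin-neg n (f ∘ suc))) (sym (ℤP.neg-distrib-+ (f zero) _))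

sumFin-zero : ∀ n → sumFin n (λ _ → + 0) ≡ + 0
sumFin-zero zero    = refl
sumFin-zero (suc n) = trans (ℤP.+-identityˡ _) (sumFin-zero n)

sumFin-punchIn : ∀ n (a : Fin (suc n)) (f : Fin (suc n) → ℤ) → sumFin (suc n) f ≡ f a + sumFin n (f ∘ punchIn a)
sumFin-punchIn n       zero    f = refl
sumFin-punchIn (suc n) (suc a) f = trans (cong (_+_ (f zero)) (sumFin-punchIn n a (f ∘ suc))) (left-comm (f zero) (f (suc a)) _)
  where
  left-comm : ∀ x y z → x + (y + z) ≡ y + (x + z)
  left-comm = solve-∀

sumFin-comm : ∀ n m (f : Fin n → Fin m → ℤ) → sumFin n (λ i → sumFin m (f i)) ≡ sumFin m (λ j → sumFin n (λ i → f i j))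
sumFin-comm zero    m f = sym (sumFin-zero m)
sumFin-comm (suc n) m f = trans (cong (_+_ (sumFin m (f zero))) (sumFin-comm n m (f ∘ suc)))
  (sym (sumFin-+ m (f zero) (λ j → sumFin n (λ i → f (suc i) j))))

sumFin-↑ : ∀ p q (f : Fin (p ℕ.+ q) → ℤ) → sumFin (p ℕ.+ q) f ≡ sumFin p (λ i → f (i ↑ˡ q)) + sumFin q (λ j → f (p ↑ʳ j))
sumFin-↑ zero    q f = sym (ℤP.+-identityˡ _)
sumFin-↑ (suc p) q f = trans (cong (_+_ (f zero)) (sumFin-↑ p q (f ∘ suc))) (sym (ℤP.+-assoc (f zero) _ _))

det-cong : ∀ n {M N : Mat n} → (∀ i j → M i j ≡ N i j) → det n M ≡ det n N
det-cong zero    M≗N = refl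
det-cong (suc n) M≗N = sumFin-cong (suc n) λ j →
  cong (sign j *_) (cong₂ _*_ (M≗N zero j) (det-cong n (λ a b → M≗N (suc a) (punchIn j b))))

adjacentSwap : ∀ {n} → Fin n → Fin (suc n) → Fin (suc n)
adjacentSwap zero    zero          = suc zero
adjacentSwap zero    (suc zero)    = zero
adjacentSwap zero    (suc (suc j)) = suc (suc j)
adjacentSwap (suc i) zero          = zero
adjacentSwap (suc i) (suc j)       = suc (adjacentSwap i j)

sumFin-adjacentSwap : ∀ n (i : Fin n) (f : Fin (suc n) → ℤ) → sumFin (suc n) (f ∘ adjacentSwap i) ≡ sumFin (suc n) f
sumFin-adjacentSwap (suc n) zero    f = left-comm (f (suc zero)) (f zero) _
  where
  left-comm : ∀ x y z → x + (y + z) ≡ y + (x + z)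
  left-comm = solve-∀
sumFin-adjacentSwap (suc n) (suc i) f = cong (_+_ (f zero)) (sumFin-adjacentSwap n i (f ∘ suc))

adjacentSwap-inject₁ : ∀ {n} (i : Fin n) → adjacentSwap i (inject₁ i) ≡ suc i
adjacentSwap-inject₁ zero    = refl
adjacentSwap-inject₁ (suc i) = cong suc (adjacentSwap-inject₁ i)

adjacentSwap-suc : ∀ {n} (i : Fin n) → adjacentSwap i (suc i) ≡ inject₁ i
adjacentSwap-suc zero    = refl
adjacentSwap-suc (suc i) = cong suc (adjacentSwap-suc i)

adjacentSwap-other : ∀ {n} (i : Fin n) j → j ≢ inject₁ i → j ≢ suc i → adjacentSwap i j ≡ j
adjacentSwap-other zero    zero          j≢i j≢1+i = ⊥-elim (j≢i refl)
adjacentSwap-other zero    (suc zero)    j≢i j≢1+i = ⊥-elim (j≢1+i refl)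
adjacentSwap-other zero    (suc (suc j)) j≢i j≢1+i = refl
adjacentSwap-other (suc i) zero          j≢i j≢1+i = refl
adjacentSwap-other (suc i) (suc j)       j≢i j≢1+i =
  cong suc (adjacentSwap-other i j (j≢i ∘ cong suc) (j≢1+i ∘ cong suc))

adjacentSwap-punchIn-inject₁ : ∀ {n} (i : Fin n) b → adjacentSwap i (punchIn (inject₁ i) b) ≡ punchIn (suc i) b
adjacentSwap-punchIn-inject₁ zero    zero    = refl
adjacentSwap-punchIn-inject₁ zero    (suc b) = refl
adjacentSwap-punchIn-inject₁ (suc i) zero    = refl
adjacentSwap-punchIn-inject₁ (suc i) (suc b) = cong suc (adjacentSwap-punchIn-inject₁ i b)

adjacentSwap-punchIn-suc : ∀ {n} (i : Fin n) b → adjacentSwap i (punchIn (suc i) b) ≡ punchIn (inject₁ i) b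
adjacentSwap-punchIn-suc zero    zero    = refl
adjacentSwap-punchIn-suc zero    (suc b) = refl
adjacentSwap-punchIn-suc (suc i) zero    = refl
adjacentSwap-punchIn-suc (suc i) (suc b) = cong suc (adjacentSwap-punchIn-suc i b)

adjacentSwap-punchIn-other : ∀ {n} (i : Fin (suc n)) (j : Fin (suc (suc n))) → j ≢ inject₁ i → j ≢ suc i →
  Σ (Fin n) λ i' → ∀ b → adjacentSwap i (punchIn j b) ≡ punchIn j (adjacentSwap i' b)
adjacentSwap-punchIn-other zero (suc zero) j≢i j≢1+i = ⊥-elim (j≢1+i refl)
adjacentSwap-punchIn-other zero zero j≢i j≢1+i = ⊥-elim (j≢i refl)
adjacentSwap-punchIn-other {suc n} zero (suc (suc j)) j≢i j≢1+i =
  zero , λ { zero → refl ; (suc zero) → refl ; (suc (suc b)) → refl }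
adjacentSwap-punchIn-other (suc i) zero j≢i j≢1+i = i , λ b → refl
adjacentSwap-punchIn-other {suc n} (suc i) (suc j) j≢i j≢1+i
  with i' , commute ← adjacentSwap-punchIn-other i j (j≢i ∘ cong suc) (j≢1+i ∘ cong suc) =
  suc i' , λ { zero → refl ; (suc b) → cong suc (commute b) }

det-swapColumns : ∀ n (i : Fin n) (M : Mat (suc n)) →
  det (suc n) (λ a b → M a (adjacentSwap i b)) ≡ - det (suc n) M
det-swapColumns (suc n) i M = begin
    sumFin (suc (suc n)) swappedTerm
  ≡⟨ sumFin-cong (suc (suc n)) swappedTerm≡ ⟩
    sumFin (suc (suc n)) (λ j → - term (adjacentSwap i j))
  ≡⟨ sumFin-neg (suc (suc n)) (term ∘ adjacentSwap i) ⟩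
    - sumFin (suc (suc n)) (term ∘ adjacentSwap i)
  ≡⟨ cong -_ (sumFin-adjacentSwap (suc n) i term) ⟩
    - sumFin (suc (suc n)) term ∎
  where
  open ≡-Reasoning
  M' : Mat (suc (suc n))
  M' a b = M a (adjacentSwap i b)
  swappedTerm term : Fin (suc (suc n)) → ℤ
  swappedTerm j = sign j * (M' zero j * det (suc n) (minor M' j))
  term        j = sign j * (M zero j * det (suc n) (minor M j))
  swap-sign : ∀ s x d → s * (x * d) ≡ - (- s * (x * d))
  swap-sign = solve-∀
  neg-inner : ∀ s x d → s * (x * - d) ≡ - (s * (x * d))
  neg-inner = solve-∀
  swappedTerm≡ : ∀ j → swappedTerm j ≡ - term (adjacentSwap i j)
  swappedTerm≡ j with j ≟ inject₁ i | j ≟ suc i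
  ... | yes refl | _ = begin
      sign (inject₁ i) * (M zero (adjacentSwap i (inject₁ i)) * det (suc n) (minor M' (inject₁ i)))
    ≡⟨ cong₂ (λ s v → s * (M zero v * det (suc n) (minor M' (inject₁ i)))) (sign-inject₁ i) (adjacentSwap-inject₁ i) ⟩
      sign i * (M zero (suc i) * det (suc n) (minor M' (inject₁ i)))
    ≡⟨ cong (λ d → sign i * (M zero (suc i) * d))
         (det-cong (suc n) (λ a b → cong (M (suc a)) (adjacentSwap-punchIn-inject₁ i b))) ⟩
      sign i * (M zero (suc i) * det (suc n) (minor M (suc i)))
    ≡⟨ swap-sign (sign i) (M zero (suc i)) _ ⟩
      - (- sign i * (M zero (suc i) * det (suc n) (minor M (suc i))))
    ≡⟨ cong (λ s → - (s * (M zero (suc i) * det (suc n) (minor M (suc i))))) (sym (sign-suc i)) ⟩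
      - term (suc i)
    ≡⟨ cong (-_ ∘ term) (sym (adjacentSwap-inject₁ i)) ⟩
      - term (adjacentSwap i (inject₁ i)) ∎
  ... | no _ | yes refl = begin
      sign (suc i) * (M zero (adjacentSwap i (suc i)) * det (suc n) (minor M' (suc i)))
    ≡⟨ cong₂ (λ s v → s * (M zero v * det (suc n) (minor M' (suc i)))) (sign-suc i) (adjacentSwap-suc i) ⟩
      - sign i * (M zero (inject₁ i) * det (suc n) (minor M' (suc i)))
    ≡⟨ cong (λ d → - sign i * (M zero (inject₁ i) * d))
         (det-cong (suc n) (λ a b → cong (M (suc a)) (adjacentSwap-punchIn-suc i b))) ⟩
      - sign i * (M zero (inject₁ i) * det (suc n) (minor M (inject₁ i)))
    ≡⟨ sym (ℤP.neg-distribˡ-* (sign i) _) ⟩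
      - (sign i * (M zero (inject₁ i) * det (suc n) (minor M (inject₁ i))))
    ≡⟨ cong (λ s → - (s * (M zero (inject₁ i) * det (suc n) (minor M (inject₁ i))))) (sym (sign-inject₁ i)) ⟩
      - term (inject₁ i)
    ≡⟨ cong (-_ ∘ term) (sym (adjacentSwap-suc i)) ⟩
      - term (adjacentSwap i (suc i)) ∎
  ... | no j≢i | no j≢1+i = begin
      sign j * (M zero (adjacentSwap i j) * det (suc n) (minor M' j))
    ≡⟨ cong (λ v → sign j * (M zero v * det (suc n) (minor M' j))) fixed ⟩
      sign j * (M zero j * det (suc n) (minor M' j))
    ≡⟨ cong (λ d → sign j * (M zero j * d)) swappedMinor ⟩
      sign j * (M zero j * - det (suc n) (minor M j))
    ≡⟨ neg-inner (sign j) (M zero j) _ ⟩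
      - term j
    ≡⟨ cong (-_ ∘ term) (sym fixed) ⟩
      - term (adjacentSwap i j) ∎
    where
    fixed = adjacentSwap-other i j j≢i j≢1+i
    swappedMinor : det (suc n) (minor M' j) ≡ - det (suc n) (minor M j)
    swappedMinor with i' , commute ← adjacentSwap-punchIn-other i j j≢i j≢1+i =
      trans (det-cong (suc n) (λ a b → cong (M (suc a)) (commute b))) (det-swapColumns n i' (minor M j))

-- Expanding det along its first two rows: column a is taken in row 0 and column b ≠ a in
-- row 1; sign₂ a b is the product of the two signs, punchIn₂ a b the remaining columns.
sign₂ : ∀ {m} → Fin m → Fin m → ℤ
sign₂ zero    zero    = + 1
sign₂ zero    (suc b) = sign b
sign₂ (suc a) zero    = - sign a
sign₂ (suc a) (suc b) = sign₂ a b

sign₂-punchIn : ∀ {n} (a : Fin (suc n)) (k : Fin n) → sign₂ a (punchIn a k) ≡ sign a * sign k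
sign₂-punchIn zero    k       = sym (ℤP.*-identityˡ (sign k))
sign₂-punchIn (suc a) zero    = sym (trans (cong (_* + 1) (sign-suc a)) (ℤP.*-identityʳ _))
sign₂-punchIn (suc a) (suc k) = trans (sign₂-punchIn a k)
  (trans (neg-*-neg (sign a) (sign k)) (sym (cong₂ _*_ (sign-suc a) (sign-suc k))))
  where
  neg-*-neg : ∀ x y → x * y ≡ - x * - y
  neg-*-neg = solve-∀

sign₂-antisym : ∀ {m} (a b : Fin m) → a ≢ b → sign₂ a b ≡ - sign₂ b a
sign₂-antisym zero    zero    a≢b = ⊥-elim (a≢b refl)
sign₂-antisym zero    (suc b) a≢b = sym (ℤP.neg-involutive (sign b))
sign₂-antisym (suc a) zero    a≢b = refl
sign₂-antisym (suc a) (suc b) a≢b = sign₂-antisym a b (a≢b ∘ cong suc)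

punchIn₂ : ∀ {n} → Fin (suc (suc n)) → Fin (suc (suc n)) → Fin n → Fin (suc (suc n))
punchIn₂ zero    zero    c = suc (suc c)
punchIn₂ zero    (suc b) c = suc (punchIn b c)
punchIn₂ (suc a) zero    c = suc (punchIn a c)
punchIn₂ {suc n} (suc a) (suc b) zero    = zero
punchIn₂ {suc n} (suc a) (suc b) (suc c) = suc (punchIn₂ a b c)

punchIn₂-punchIn : ∀ {n} (a : Fin (suc (suc n))) (k : Fin (suc n)) c → punchIn₂ a (punchIn a k) c ≡ punchIn a (punchIn k c)
punchIn₂-punchIn zero    k       c       = refl
punchIn₂-punchIn (suc a) zero    c       = refl
punchIn₂-punchIn {suc n} (suc a) (suc k) zero    = refl
punchIn₂-punchIn {suc n} (suc a) (suc k) (suc c) = cong suc (punchIn₂-punchIn a k c)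

punchIn₂-comm : ∀ {n} (a b : Fin (suc (suc n))) → a ≢ b → ∀ c → punchIn₂ a b c ≡ punchIn₂ b a c
punchIn₂-comm zero    zero    a≢b c = ⊥-elim (a≢b refl)
punchIn₂-comm zero    (suc b) a≢b c = refl
punchIn₂-comm (suc a) zero    a≢b c = refl
punchIn₂-comm {suc n} (suc a) (suc b) a≢b zero    = refl
punchIn₂-comm {suc n} (suc a) (suc b) a≢b (suc c) = cong suc (punchIn₂-comm a b (a≢b ∘ cong suc) c)

expansion₂ : ∀ n → Mat (suc (suc n)) → Fin (suc (suc n)) → Fin (suc (suc n)) → ℤ
expansion₂ n M a b = sign₂ a b * (M zero a * (M (suc zero) b * det n (λ r c → M (suc (suc r)) (punchIn₂ a b c))))

det-expand₂ : ∀ n (M : Mat (suc (suc n))) →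
  det (suc (suc n)) M ≡ sumFin (suc (suc n)) (λ a → sumFin (suc n) (λ k → expansion₂ n M a (punchIn a k)))
det-expand₂ n M = sumFin-cong (suc (suc n)) λ a → begin
    sign a * (M zero a * sumFin (suc n) (inner a))
  ≡⟨ cong (sign a *_) (sumFin-*ˡ (suc n) (M zero a) (inner a)) ⟩
    sign a * sumFin (suc n) (λ k → M zero a * inner a k)
  ≡⟨ sumFin-*ˡ (suc n) (sign a) (λ k → M zero a * inner a k) ⟩
    sumFin (suc n) (λ k → sign a * (M zero a * inner a k))
  ≡⟨ sumFin-cong (suc n) (expansion₂≡ a) ⟩
    sumFin (suc n) (λ k → expansion₂ n M a (punchIn a k)) ∎
  where
  open ≡-Reasoning
  inner : Fin (suc (suc n)) → Fin (suc n) → ℤ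
  inner a k = sign k * (M (suc zero) (punchIn a k) * det n (minor (minor M a) k))
  reassoc : ∀ s t x y d → s * (x * (t * (y * d))) ≡ (s * t) * (x * (y * d))
  reassoc = solve-∀
  expansion₂≡ : ∀ a k → sign a * (M zero a * inner a k) ≡ expansion₂ n M a (punchIn a k)
  expansion₂≡ a k = trans (reassoc (sign a) (sign k) (M zero a) (M (suc zero) (punchIn a k)) _)
    (cong₂ (λ s d → s * (M zero a * (M (suc zero) (punchIn a k) * d))) (sym (sign₂-punchIn a k))
      (det-cong n (λ r c → cong (M (suc (suc r))) (sym (punchIn₂-punchIn a k c)))))

sumFin-offDiagonal-transpose : ∀ N (h : Fin (suc N) → Fin (suc N) → ℤ) →
  sumFin (suc N) (λ a → sumFin N (λ k → h a (punchIn a k))) ≡ sumFin (suc N) (λ a → sumFin N (λ k → h (punchIn a k) a))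
sumFin-offDiagonal-transpose N h = ∙-cancelˡ diagonal _ _ (begin
    diagonal + sumFin (suc N) (λ a → sumFin N (λ k → h a (punchIn a k)))
  ≡⟨ sym (sumFin-+ (suc N) (λ a → h a a) (λ a → sumFin N (λ k → h a (punchIn a k)))) ⟩
    sumFin (suc N) (λ a → h a a + sumFin N (λ k → h a (punchIn a k)))
  ≡⟨ sumFin-cong (suc N) (λ a → sym (sumFin-punchIn N a (h a))) ⟩
    sumFin (suc N) (λ a → sumFin (suc N) (h a))
  ≡⟨ sumFin-comm (suc N) (suc N) h ⟩
    sumFin (suc N) (λ b → sumFin (suc N) (λ a → h a b))
  ≡⟨ sumFin-cong (suc N) (λ b → sumFin-punchIn N b (λ a → h a b)) ⟩
    sumFin (suc N) (λ b → h b b + sumFin N (λ k → h (punchIn b k) b))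
  ≡⟨ sumFin-+ (suc N) (λ b → h b b) (λ b → sumFin N (λ k → h (punchIn b k) b)) ⟩
    diagonal + sumFin (suc N) (λ b → sumFin N (λ k → h (punchIn b k) b)) ∎)
  where
  open ≡-Reasoning
  diagonal = sumFin (suc N) (λ a → h a a)

-- Swapping rows 0 and 1 transposes expansion₂, which is antisymmetric.
det-swapRows : ∀ n (i : Fin n) (M : Mat (suc n)) →
  det (suc n) (λ a b → M (adjacentSwap i a) b) ≡ - det (suc n) M
det-swapRows (suc n) zero M = begin
    det (suc (suc n)) M'
  ≡⟨ det-expand₂ n M' ⟩
    sumFin (suc (suc n)) (λ a → sumFin (suc n) (λ k → expansion₂ n M' a (punchIn a k)))
  ≡⟨ sumFin-cong (suc (suc n)) (λ a → sumFin-cong (suc n) (λ k → transposed a k)) ⟩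
    sumFin (suc (suc n)) (λ a → sumFin (suc n) (λ k → - expansion₂ n M (punchIn a k) a))
  ≡⟨ sumFin-cong (suc (suc n)) (λ a → sumFin-neg (suc n) (λ k → expansion₂ n M (punchIn a k) a)) ⟩
    sumFin (suc (suc n)) (λ a → - sumFin (suc n) (λ k → expansion₂ n M (punchIn a k) a))
  ≡⟨ sumFin-neg (suc (suc n)) (λ a → sumFin (suc n) (λ k → expansion₂ n M (punchIn a k) a)) ⟩
    - sumFin (suc (suc n)) (λ a → sumFin (suc n) (λ k → expansion₂ n M (punchIn a k) a))
  ≡⟨ cong -_ (sym (sumFin-offDiagonal-transpose (suc n) (expansion₂ n M))) ⟩
    - sumFin (suc (suc n)) (λ a → sumFin (suc n) (λ k → expansion₂ n M a (punchIn a k)))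
  ≡⟨ cong -_ (sym (det-expand₂ n M)) ⟩
    - det (suc (suc n)) M ∎
  where
  open ≡-Reasoning
  M' : Mat (suc (suc n))
  M' a b = M (adjacentSwap zero a) b
  rearrange : ∀ s x y d → (- s) * (x * (y * d)) ≡ - (s * (y * (x * d)))
  rearrange = solve-∀
  transposed : ∀ a k → expansion₂ n M' a (punchIn a k) ≡ - expansion₂ n M (punchIn a k) a
  transposed a k =
    trans (cong₂ (λ s d → s * (M (suc zero) a * (M zero b * d))) (sign₂-antisym a b a≢b)
            (det-cong n (λ r c → cong (M (suc (suc r))) (punchIn₂-comm a b a≢b c))))
          (rearrange (sign₂ b a) (M (suc zero) a) (M zero b) _)
    where
    b = punchIn a k
    a≢b : a ≢ b
    a≢b = FP.punchInᵢ≢i a k ∘ sym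
det-swapRows (suc (suc n)) (suc i) M = begin
    sumFin (suc (suc (suc n))) (λ j → sign j * (M zero j * det (suc (suc n)) (λ a b → M (suc (adjacentSwap i a)) (punchIn j b))))
  ≡⟨ sumFin-cong (suc (suc (suc n))) (λ j → cong (λ d → sign j * (M zero j * d)) (det-swapRows (suc n) i (minor M j))) ⟩
    sumFin (suc (suc (suc n))) (λ j → sign j * (M zero j * - det (suc (suc n)) (minor M j)))
  ≡⟨ sumFin-cong (suc (suc (suc n))) (λ j → neg-inner (sign j) (M zero j) (det (suc (suc n)) (minor M j))) ⟩
    sumFin (suc (suc (suc n))) (λ j → - (sign j * (M zero j * det (suc (suc n)) (minor M j))))
  ≡⟨ sumFin-neg (suc (suc (suc n))) (λ j → sign j * (M zero j * det (suc (suc n)) (minor M j))) ⟩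
    - det (suc (suc (suc n))) M ∎
  where
  open ≡-Reasoning
  neg-inner : ∀ s x d → s * (x * - d) ≡ - (s * (x * d))
  neg-inner = solve-∀

DetInvariant : ∀ n → (Fin n → Fin n) → Set
DetInvariant n σ = ∀ (M : Mat n) → det n (λ a b → M (σ a) (σ b)) ≡ det n M

detInvariant-∘ : ∀ n {σ τ : Fin n → Fin n} → DetInvariant n σ → DetInvariant n τ → DetInvariant n (σ ∘ τ)
detInvariant-∘ n {σ} invσ invτ M = trans (invτ (λ a b → M (σ a) (σ b))) (invσ M)

detInvariant-cong : ∀ n {σ τ : Fin n → Fin n} → DetInvariant n σ → (∀ i → σ i ≡ τ i) → DetInvariant n τ
detInvariant-cong n invσ σ≗τ M = trans (det-cong n (λ a b → cong₂ M (sym (σ≗τ a)) (sym (σ≗τ b)))) (invσ M)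

detInvariant-adjacentSwap : ∀ n (i : Fin n) → DetInvariant (suc n) (adjacentSwap i)
detInvariant-adjacentSwap n i M = trans (det-swapRows n i (λ a b → M a (adjacentSwap i b)))
  (trans (cong -_ (det-swapColumns n i M)) (ℤP.neg-involutive _))

rotate : ∀ {n} → Fin (suc n) → Fin (suc n) → Fin (suc n)
rotate p zero    = p
rotate p (suc i) = punchIn p i

rotate-zero : ∀ {n} (j : Fin (suc n)) → rotate zero j ≡ j
rotate-zero zero    = refl
rotate-zero (suc j) = refl

rotate-suc : ∀ {n} (p : Fin n) j → rotate (suc p) j ≡ adjacentSwap p (rotate (inject₁ p) j)
rotate-suc p zero    = sym (adjacentSwap-inject₁ p)
rotate-suc p (suc j) = sym (adjacentSwap-punchIn-inject₁ p j)

detInvariant-rotate : ∀ n (p : Fin (suc n)) → DetInvariant (suc n) (rotate p)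
detInvariant-rotate n p = byDistance (toℕ p) n p refl
  where
  byDistance : ∀ t n (p : Fin (suc n)) → toℕ p ≡ t → DetInvariant (suc n) (rotate p)
  byDistance _       n       zero    _ = detInvariant-cong (suc n) {id} {rotate zero} (λ M → refl) (sym ∘ rotate-zero)
  byDistance zero    n       (suc p) ()
  byDistance (suc t) (suc n) (suc p) toℕp≡t =
    detInvariant-cong (suc (suc n)) {adjacentSwap p ∘ rotate (inject₁ p)} {rotate (suc p)}
      (detInvariant-∘ (suc (suc n)) {adjacentSwap p} {rotate (inject₁ p)} (detInvariant-adjacentSwap (suc n) p)
        (byDistance t (suc n) (inject₁ p) (trans (FP.toℕ-inject₁ p) (ℕP.suc-injective toℕp≡t))))
      (sym ∘ rotate-suc p)

punchIn-↑ˡ : ∀ {p} (i : Fin (suc p)) (b : Fin p) q → punchIn (i ↑ˡ q) (b ↑ˡ q) ≡ punchIn i b ↑ˡ q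
punchIn-↑ˡ zero    b       q = refl
punchIn-↑ˡ (suc i) zero    q = refl
punchIn-↑ˡ (suc i) (suc b) q = cong suc (punchIn-↑ˡ i b q)

punchIn-↑ʳ : ∀ {p} (i : Fin (suc p)) q (b : Fin q) → punchIn (i ↑ˡ q) (p ↑ʳ b) ≡ suc p ↑ʳ b
punchIn-↑ʳ zero            q b = refl
punchIn-↑ʳ {suc p} (suc i) q b = cong suc (punchIn-↑ʳ i q b)

det-lowerBlock : ∀ p q (M : Mat (p ℕ.+ q)) → (∀ i j → M (i ↑ˡ q) (p ↑ʳ j) ≡ + 0) →
  det (p ℕ.+ q) M ≡ det p (λ i j → M (i ↑ˡ q) (j ↑ˡ q)) * det q (λ i j → M (p ↑ʳ i) (p ↑ʳ j))
det-lowerBlock zero    q M upperRight≡0 = sym (ℤP.*-identityˡ _)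
det-lowerBlock (suc p) q M upperRight≡0 = begin
    sumFin (suc p ℕ.+ q) term
  ≡⟨ sumFin-↑ (suc p) q term ⟩
    sumFin (suc p) (λ i → term (i ↑ˡ q)) + sumFin q (λ j → term (suc p ↑ʳ j))
  ≡⟨ cong₂ _+_ (sumFin-cong (suc p) leftTerm) (trans (sumFin-cong q rightTerm) (sumFin-zero q)) ⟩
    sumFin (suc p) (λ i → sign i * (M zero (i ↑ˡ q) * det p (minor TL i)) * det q BR) + + 0
  ≡⟨ ℤP.+-identityʳ _ ⟩
    sumFin (suc p) (λ i → sign i * (M zero (i ↑ˡ q) * det p (minor TL i)) * det q BR)
  ≡⟨ sym (sumFin-*ʳ (suc p) (det q BR) (λ i → sign i * (M zero (i ↑ˡ q) * det p (minor TL i)))) ⟩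
    det (suc p) TL * det q BR ∎
  where
  open ≡-Reasoning
  term : Fin (suc p ℕ.+ q) → ℤ
  term j = sign j * (M zero j * det (p ℕ.+ q) (minor M j))
  TL : Mat (suc p)
  TL i j = M (i ↑ˡ q) (j ↑ˡ q)
  BR : Mat q
  BR i j = M (suc p ↑ʳ i) (suc p ↑ʳ j)
  rightTerm : ∀ j → term (suc p ↑ʳ j) ≡ + 0
  rightTerm j = trans (cong (λ v → sign (suc p ↑ʳ j) * (v * det (p ℕ.+ q) (minor M (suc p ↑ʳ j)))) (upperRight≡0 zero j))
    (trans (cong (sign (suc p ↑ʳ j) *_) (ℤP.*-zeroˡ (det (p ℕ.+ q) (minor M (suc p ↑ʳ j))))) (ℤP.*-zeroʳ (sign (suc p ↑ʳ j))))
  reassoc : ∀ s x a b → s * (x * (a * b)) ≡ s * (x * a) * b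
  reassoc = solve-∀
  leftTerm : ∀ i → term (i ↑ˡ q) ≡ sign i * (M zero (i ↑ˡ q) * det p (minor TL i)) * det q BR
  leftTerm i = begin
      sign (i ↑ˡ q) * (M zero (i ↑ˡ q) * det (p ℕ.+ q) (minor M (i ↑ˡ q)))
    ≡⟨ cong₂ (λ s d → s * (M zero (i ↑ˡ q) * d)) (sign-↑ˡ i q)
        (det-lowerBlock p q (minor M (i ↑ˡ q))
          (λ a b → trans (cong (M (suc (a ↑ˡ q))) (punchIn-↑ʳ i q b)) (upperRight≡0 (suc a) b))) ⟩
      sign i * (M zero (i ↑ˡ q) * (det p (λ a b → M (suc (a ↑ˡ q)) (punchIn (i ↑ˡ q) (b ↑ˡ q)))
                                   * det q (λ a b → M (suc (p ↑ʳ a)) (punchIn (i ↑ˡ q) (p ↑ʳ b)))))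
    ≡⟨ cong₂ (λ d₁ d₂ → sign i * (M zero (i ↑ˡ q) * (d₁ * d₂)))
        (det-cong p (λ a b → cong (M (suc (a ↑ˡ q))) (punchIn-↑ˡ i b q)))
        (det-cong q (λ a b → cong (M (suc (p ↑ʳ a))) (punchIn-↑ʳ i q b))) ⟩
      sign i * (M zero (i ↑ˡ q) * (det p (minor TL i) * det q BR))
    ≡⟨ reassoc (sign i) (M zero (i ↑ˡ q)) (det p (minor TL i)) (det q BR) ⟩
      sign i * (M zero (i ↑ˡ q) * det p (minor TL i)) * det q BR ∎

toℕ-punchIn-< : ∀ {n} (j : Fin (suc n)) (b : Fin n) → toℕ b ℕ.< toℕ j → toℕ (punchIn j b) ≡ toℕ b
toℕ-punchIn-< (suc j) zero    b<j       = refl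
toℕ-punchIn-< (suc j) (suc b) (s≤s b<j) = cong suc (toℕ-punchIn-< j b b<j)

toℕ-punchIn-≥ : ∀ {n} (j : Fin (suc n)) (b : Fin n) → toℕ j ≤ toℕ b → toℕ (punchIn j b) ≡ suc (toℕ b)
toℕ-punchIn-≥ zero    b       j≤b       = refl
toℕ-punchIn-≥ (suc j) (suc b) (s≤s j≤b) = cong suc (toℕ-punchIn-≥ j b j≤b)

toℕ-punchIn-≤ : ∀ {n} (j : Fin (suc n)) (b : Fin n) → toℕ (punchIn j b) ≤ suc (toℕ b)
toℕ-punchIn-≤ zero    b       = ℕP.≤-refl
toℕ-punchIn-≤ (suc j) zero    = z≤n
toℕ-punchIn-≤ (suc j) (suc b) = s≤s (toℕ-punchIn-≤ j b)

*-zero-middle : ∀ s x d → x ≡ + 0 → s * (x * d) ≡ + 0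
*-zero-middle s x d refl = trans (cong (s *_) (ℤP.*-zeroˡ d)) (ℤP.*-zeroʳ s)

*-zero-right : ∀ s x d → d ≡ + 0 → s * (x * d) ≡ + 0
*-zero-right s x d refl = trans (cong (s *_) (ℤP.*-zeroʳ x)) (ℤP.*-zeroʳ s)

-- The rows from t on have all their nonzero entries among the last n ∸ c < n ∸ t columns.
det-zeroBlock : ∀ n (M : Mat n) t c → t ℕ.< c → c ≤ n →
  (∀ i j → t ≤ toℕ i → toℕ j ℕ.< c → M i j ≡ + 0) → det n M ≡ + 0
det-zeroBlock zero    M t c t<c c≤0 vanish = ⊥-elim (ℕP.<-irrefl refl (ℕP.<-≤-trans (ℕP.≤-<-trans z≤n t<c) c≤0))
det-zeroBlock (suc n) M t c t<c c≤n vanish = trans (sumFin-cong (suc n) (term≡0 t t<c vanish)) (sumFin-zero (suc n))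
  where
  c≤j⇒c≤n : ∀ (j : Fin (suc n)) → c ≤ toℕ j → c ≤ n
  c≤j⇒c≤n j c≤j = ℕP.≤-pred (ℕP.≤-trans (s≤s c≤j) (FP.toℕ<n j))
  minorKeepsBlock : ∀ j → ¬ toℕ j ℕ.< c → ∀ b → toℕ b ℕ.< c → toℕ (punchIn j b) ℕ.< c
  minorKeepsBlock j j≮c b b<c = subst (ℕ._< c) (sym (toℕ-punchIn-< j b (ℕP.<-≤-trans b<c (ℕP.≮⇒≥ j≮c)))) b<c
  term≡0 : ∀ t → t ℕ.< c → (∀ i j → t ≤ toℕ i → toℕ j ℕ.< c → M i j ≡ + 0) →
           ∀ j → sign j * (M zero j * det n (minor M j)) ≡ + 0
  term≡0 t t<c vanish j with toℕ j ℕ.<? c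
  term≡0 zero t<c vanish j | yes j<c = *-zero-middle (sign j) (M zero j) _ (vanish zero j z≤n j<c)
  term≡0 (suc t) t<c vanish j | yes j<c = *-zero-right (sign j) (M zero j) _ (shrunk c t<c c≤n vanish)
    where
    shrunk : ∀ c → suc t ℕ.< c → c ≤ suc n → (∀ i j → suc t ≤ toℕ i → toℕ j ℕ.< c → M i j ≡ + 0) →
             det n (minor M j) ≡ + 0
    shrunk (suc c) (s≤s t<c) (s≤s c≤n) vanish = det-zeroBlock n (minor M j) t c t<c c≤n
      (λ a b t≤a b<c → vanish (suc a) (punchIn j b) (s≤s t≤a) (ℕP.≤-<-trans (toℕ-punchIn-≤ j b) (s≤s b<c)))
  term≡0 zero t<c vanish j | no j≮c = *-zero-right (sign j) (M zero j) _
    (det-zeroBlock n (minor M j) zero c t<c (c≤j⇒c≤n j (ℕP.≮⇒≥ j≮c))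
      (λ a b _ b<c → vanish (suc a) (punchIn j b) z≤n (minorKeepsBlock j j≮c b b<c)))
  term≡0 (suc t) t<c vanish j | no j≮c = *-zero-right (sign j) (M zero j) _
    (det-zeroBlock n (minor M j) t c (ℕP.<-trans (ℕP.n<1+n t) t<c) (c≤j⇒c≤n j (ℕP.≮⇒≥ j≮c))
      (λ a b t≤a b<c → vanish (suc a) (punchIn j b) (s≤s t≤a) (minorKeepsBlock j j≮c b b<c)))

det-linear-row₀ : ∀ n (M N₁ N₂ : Mat (suc n)) → (∀ j → M zero j ≡ N₁ zero j + N₂ zero j) →
  (∀ a b → M (suc a) b ≡ N₁ (suc a) b) → (∀ a b → M (suc a) b ≡ N₂ (suc a) b) →
  det (suc n) M ≡ det (suc n) N₁ + det (suc n) N₂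
det-linear-row₀ n M N₁ N₂ row₀ rest₁ rest₂ =
  trans (sumFin-cong (suc n) term≡) (sumFin-+ (suc n) (term N₁) (term N₂))
  where
  term : Mat (suc n) → Fin (suc n) → ℤ
  term N j = sign j * (N zero j * det n (minor N j))
  distrib : ∀ s x y d → s * ((x + y) * d) ≡ s * (x * d) + s * (y * d)
  distrib = solve-∀
  term≡ : ∀ j → term M j ≡ term N₁ j + term N₂ j
  term≡ j = trans (cong₂ (λ x d → sign j * (x * d)) (row₀ j) (det-cong n (λ a b → rest₁ a (punchIn j b))))
    (trans (distrib (sign j) (N₁ zero j) (N₂ zero j) (det n (minor N₁ j)))
      (cong (λ d → term N₁ j + sign j * (N₂ zero j * d))
        (det-cong n (λ a b → trans (sym (rest₁ a (punchIn j b))) (rest₂ a (punchIn j b))))))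

det-linear-col₀ : ∀ n (M N₁ N₂ : Mat (suc n)) → (∀ i → M i zero ≡ N₁ i zero + N₂ i zero) →
  (∀ a b → M a (suc b) ≡ N₁ a (suc b)) → (∀ a b → M a (suc b) ≡ N₂ a (suc b)) →
  det (suc n) M ≡ det (suc n) N₁ + det (suc n) N₂
det-linear-col₀ n M N₁ N₂ col₀ rest₁ rest₂ =
  trans (sumFin-cong (suc n) (term≡ n M N₁ N₂ col₀ rest₁ rest₂)) (sumFin-+ (suc n) (term N₁) (term N₂))
  where
  term : ∀ {n} → Mat (suc n) → Fin (suc n) → ℤ
  term {n} N j = sign j * (N zero j * det n (minor N j))
  distribˡ : ∀ s x y d → s * ((x + y) * d) ≡ s * (x * d) + s * (y * d)
  distribˡ = solve-∀
  distribʳ : ∀ s x d₁ d₂ → s * (x * (d₁ + d₂)) ≡ s * (x * d₁) + s * (x * d₂)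
  distribʳ = solve-∀
  term≡ : ∀ n (M N₁ N₂ : Mat (suc n)) → (∀ i → M i zero ≡ N₁ i zero + N₂ i zero) →
    (∀ a b → M a (suc b) ≡ N₁ a (suc b)) → (∀ a b → M a (suc b) ≡ N₂ a (suc b)) →
    ∀ j → term M j ≡ term N₁ j + term N₂ j
  term≡ n M N₁ N₂ col₀ rest₁ rest₂ zero =
    trans (cong₂ (λ x d → sign {suc n} zero * (x * d)) (col₀ zero) (det-cong n (λ a b → rest₁ (suc a) b)))
      (trans (distribˡ (sign {suc n} zero) (N₁ zero zero) (N₂ zero zero) (det n (minor N₁ zero)))
        (cong (λ d → term N₁ zero + sign {suc n} zero * (N₂ zero zero * d))
          (det-cong n (λ a b → trans (sym (rest₁ (suc a) b)) (rest₂ (suc a) b)))))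
  term≡ (suc n) M N₁ N₂ col₀ rest₁ rest₂ (suc j) =
    trans (cong (λ d → sign (suc j) * (M zero (suc j) * d))
            (det-linear-col₀ n (minor M (suc j)) (minor N₁ (suc j)) (minor N₂ (suc j)) (col₀ ∘ suc)
              (λ a b → rest₁ (suc a) (punchIn j b)) (λ a b → rest₂ (suc a) (punchIn j b))))
      (trans (distribʳ (sign (suc j)) (M zero (suc j)) (det (suc n) (minor N₁ (suc j))) (det (suc n) (minor N₂ (suc j))))
        (cong₂ (λ x y → sign (suc j) * (x * det (suc n) (minor N₁ (suc j))) + sign (suc j) * (y * det (suc n) (minor N₂ (suc j))))
          (rest₁ zero j) (rest₂ zero j)))

data Split (p q : ℕ) : Fin (p ℕ.+ q) → Set where
  left  : (s : Fin p) → Split p q (s ↑ˡ q)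
  right : (g : Fin q) → Split p q (p ↑ʳ g)

split : ∀ p q (c : Fin (p ℕ.+ q)) → Split p q c
split zero    q c       = right c
split (suc p) q zero    = left zero
split (suc p) q (suc c) with split p q c
... | left s  = left (suc s)
... | right g = right g

zeros : ∀ {k} → Fin k → ℤ
zeros _ = + 0

either : ∀ {p q} {X : Set} → (Fin p → X) → (Fin q → X) → Fin (p ℕ.+ q) → X
either {p} f g = [ f , g ]′ ∘ splitAt p

either-↑ˡ : ∀ {p q} {X : Set} (f : Fin p → X) (g : Fin q → X) s → either f g (s ↑ˡ q) ≡ f s
either-↑ˡ {p} {q} f g s rewrite FP.splitAt-↑ˡ p s q = refl

either-↑ʳ : ∀ {p q} {X : Set} (f : Fin p → X) (g : Fin q → X) t → either {p} f g (p ↑ʳ t) ≡ g t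
either-↑ʳ {p} {q} f g t rewrite FP.splitAt-↑ʳ p q t = refl

either-split : ∀ {p q} (f : Fin p → ℤ) (g : Fin q → ℤ) c → either f g c ≡ either f zeros c + either zeros g c
either-split {p} {q} f g c with split p q c
... | left s  = trans (either-↑ˡ f g s)
                  (sym (trans (cong₂ _+_ (either-↑ˡ f zeros s) (either-↑ˡ zeros g s)) (ℤP.+-identityʳ (f s))))
... | right t = trans (either-↑ʳ {p} f g t)
                  (sym (trans (cong₂ _+_ (either-↑ʳ {p} f zeros t) (either-↑ʳ {p} zeros g t)) (ℤP.+-identityˡ (g t))))

det-cast : ∀ {n m} (n≡m : n ≡ m) (M : Mat n) → det n M ≡ det m (λ a b → M (cast (sym n≡m) a) (cast (sym n≡m) b))
det-cast {n} refl M = det-cong n (λ a b → sym (cong₂ M (FP.cast-is-id refl a) (FP.cast-is-id refl b)))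

border : ∀ {n} → ℤ → (Fin n → ℤ) → (Fin n → ℤ) → Mat n → Mat (suc n)
border y r c A zero    zero    = y
border y r c A zero    (suc j) = r j
border y r c A (suc i) zero    = c i
border y r c A (suc i) (suc j) = A i j

det-border-zeros : ∀ n y (c : Fin n → ℤ) (A : Mat n) → det (suc n) (border y zeros c A) ≡ y * det n A
det-border-zeros n y c A = trans (det-lowerBlock 1 n (border y zeros c A) (λ { zero j → refl }))
  (cong (_* det n A) (trans (ℤP.+-identityʳ _) (trans (ℤP.*-identityˡ _) (ℤP.*-identityʳ y))))

det-border-zeroCorner : ∀ n x (r c : Fin n → ℤ) (A : Mat n) →
  det (suc n) (border (+ 0) r c A) ≡ det (suc n) (border x r c A) - x * det n A
det-border-zeroCorner n x r c A = sym (begin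
    det (suc n) (border x r c A) - x * det n A
  ≡⟨ cong (_- x * det n A) (det-linear-row₀ n (border x r c A) (border (+ 0) r c A) (border x zeros c A)
                              row₀ sameRows sameRows) ⟩
    det (suc n) (border (+ 0) r c A) + det (suc n) (border x zeros c A) - x * det n A
  ≡⟨ cong (λ d → det (suc n) (border (+ 0) r c A) + d - x * det n A) (det-border-zeros n x c A) ⟩
    det (suc n) (border (+ 0) r c A) + x * det n A - x * det n A
  ≡⟨ add-sub _ _ ⟩
    det (suc n) (border (+ 0) r c A) ∎)
  where
  open ≡-Reasoning
  row₀ : ∀ j → border x r c A zero j ≡ border (+ 0) r c A zero j + border x zeros c A zero j
  row₀ zero    = sym (ℤP.+-identityˡ x)
  row₀ (suc j) = sym (ℤP.+-identityʳ (r j))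
  sameRows : ∀ {y y' r r'} (a : Fin n) b → border y r c A (suc a) b ≡ border y' r' c A (suc a) b
  sameRows a zero    = refl
  sameRows a (suc b) = refl
  add-sub : ∀ a b → a + b - b ≡ a
  add-sub = solve-∀

-- glued y r₁ r₂ c₁ c₂ = [[y, r₁, r₂], [c₁, A, 0], [c₂, 0, D]]
module Glued (p q : ℕ) (A : Mat p) (D : Mat q) where

  blockDiag : Mat (p ℕ.+ q)
  blockDiag a b = either (λ s → either (A s) zeros b) (λ g → either zeros (D g) b) a

  glued : ℤ → (Fin p → ℤ) → (Fin q → ℤ) → (Fin p → ℤ) → (Fin q → ℤ) → Mat (suc (p ℕ.+ q))
  glued y r₁ r₂ c₁ c₂ zero    zero    = y
  glued y r₁ r₂ c₁ c₂ zero    (suc b) = either r₁ r₂ b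
  glued y r₁ r₂ c₁ c₂ (suc a) zero    = either c₁ c₂ a
  glued y r₁ r₂ c₁ c₂ (suc a) (suc b) = blockDiag a b

  blockDiag-ll : ∀ s s' → blockDiag (s ↑ˡ q) (s' ↑ˡ q) ≡ A s s'
  blockDiag-ll s s' = trans (either-↑ˡ _ _ s) (either-↑ˡ _ _ s')
  blockDiag-lr : ∀ s g → blockDiag (s ↑ˡ q) (p ↑ʳ g) ≡ + 0
  blockDiag-lr s g = trans (either-↑ˡ _ _ s) (either-↑ʳ {p} (A s) zeros g)
  blockDiag-rl : ∀ g s → blockDiag (p ↑ʳ g) (s ↑ˡ q) ≡ + 0
  blockDiag-rl g s = trans (either-↑ʳ {p} _ _ g) (either-↑ˡ zeros (D g) s)
  blockDiag-rr : ∀ g g' → blockDiag (p ↑ʳ g) (p ↑ʳ g') ≡ D g g'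
  blockDiag-rr g g' = trans (either-↑ʳ {p} _ _ g) (either-↑ʳ {p} zeros (D g) g')

  toMiddle : Fin (suc (p ℕ.+ q)) → Fin (p ℕ.+ suc q)
  toMiddle zero    = p ↑ʳ zero
  toMiddle (suc c) = either (_↑ˡ suc q) (λ g → p ↑ʳ suc g) c

  fromMiddle : Fin (p ℕ.+ suc q) → Fin (suc (p ℕ.+ q))
  fromMiddle = either (λ s → suc (s ↑ˡ q)) λ { zero → zero ; (suc g) → suc (p ↑ʳ g) }

  fromMiddle-toMiddle : ∀ a → fromMiddle (toMiddle a) ≡ a
  fromMiddle-toMiddle zero = either-↑ʳ {p} _ _ zero
  fromMiddle-toMiddle (suc c) with split p q c
  ... | left s  = trans (cong fromMiddle (either-↑ˡ _ _ s)) (either-↑ˡ _ _ s)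
  ... | right g = trans (cong fromMiddle (either-↑ʳ {p} _ _ g)) (either-↑ʳ {p} _ _ (suc g))

  -- toMiddle is the rotation bringing position p to the front, up to p + suc q ≡ suc (p + q).
  det-toMiddle : ∀ (N : Mat (p ℕ.+ suc q)) → det (suc (p ℕ.+ q)) (λ a b → N (toMiddle a) (toMiddle b)) ≡ det (p ℕ.+ suc q) N
  det-toMiddle N = trans (det-cong (suc (p ℕ.+ q)) (λ a b → cong₂ N (toMiddle≡ a) (toMiddle≡ b)))
    (trans (detInvariant-rotate (p ℕ.+ q) pivot N') (sym (det-cast e N)))
    where
    e : p ℕ.+ suc q ≡ suc (p ℕ.+ q)
    e = ℕP.+-suc p q
    N' : Mat (suc (p ℕ.+ q))
    N' a b = N (cast (sym e) a) (cast (sym e) b)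
    pivot : Fin (suc (p ℕ.+ q))
    pivot = cast e (p ↑ʳ zero)
    toℕ-pivot : toℕ pivot ≡ p
    toℕ-pivot = trans (FP.toℕ-cast e (p ↑ʳ zero)) (trans (FP.toℕ-↑ʳ p zero) (ℕP.+-identityʳ p))
    toℕ-toMiddle : ∀ a → toℕ (toMiddle a) ≡ toℕ (rotate pivot a)
    toℕ-toMiddle zero = sym (FP.toℕ-cast e (p ↑ʳ zero))
    toℕ-toMiddle (suc c) with split p q c
    ... | left s = begin
        toℕ (toMiddle (suc (s ↑ˡ q)))  ≡⟨ cong toℕ (either-↑ˡ _ _ s) ⟩
        toℕ (s ↑ˡ suc q)               ≡⟨ FP.toℕ-↑ˡ s (suc q) ⟩
        toℕ s                          ≡⟨ sym (FP.toℕ-↑ˡ s q) ⟩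
        toℕ (s ↑ˡ q)                   ≡⟨ sym (toℕ-punchIn-< pivot (s ↑ˡ q) s<pivot) ⟩
        toℕ (punchIn pivot (s ↑ˡ q))   ∎
      where
      open ≡-Reasoning
      s<pivot : toℕ (s ↑ˡ q) ℕ.< toℕ pivot
      s<pivot = subst₂ ℕ._<_ (sym (FP.toℕ-↑ˡ s q)) (sym toℕ-pivot) (FP.toℕ<n s)
    ... | right g = begin
        toℕ (toMiddle (suc (p ↑ʳ g)))  ≡⟨ cong toℕ (either-↑ʳ {p} _ _ g) ⟩
        toℕ (p ↑ʳ suc g)               ≡⟨ FP.toℕ-↑ʳ p (suc g) ⟩
        p ℕ.+ suc (toℕ g)              ≡⟨ ℕP.+-suc p (toℕ g) ⟩
        suc (p ℕ.+ toℕ g)              ≡⟨ cong suc (sym (FP.toℕ-↑ʳ p g)) ⟩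
        suc (toℕ (p ↑ʳ g))             ≡⟨ sym (toℕ-punchIn-≥ pivot (p ↑ʳ g) pivot≤g) ⟩
        toℕ (punchIn pivot (p ↑ʳ g))   ∎
      where
      open ≡-Reasoning
      pivot≤g : toℕ pivot ≤ toℕ (p ↑ʳ g)
      pivot≤g = subst₂ _≤_ (sym toℕ-pivot) (sym (FP.toℕ-↑ʳ p g)) (ℕP.m≤m+n p (toℕ g))
    toMiddle≡ : ∀ a → toMiddle a ≡ cast (sym e) (rotate pivot a)
    toMiddle≡ a = FP.toℕ-injective (trans (toℕ-toMiddle a) (sym (FP.toℕ-cast (sym e) (rotate pivot a))))

  det-fromMiddle : ∀ (M : Mat (suc (p ℕ.+ q))) →
    det (suc (p ℕ.+ q)) M ≡ det (p ℕ.+ suc q) (λ a b → M (fromMiddle a) (fromMiddle b))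
  det-fromMiddle M =
    trans (det-cong (suc (p ℕ.+ q)) (λ a b → sym (cong₂ M (fromMiddle-toMiddle a) (fromMiddle-toMiddle b))))
          (det-toMiddle (λ a b → M (fromMiddle a) (fromMiddle b)))

  fromMiddle-left : ∀ s → fromMiddle (s ↑ˡ suc q) ≡ suc (s ↑ˡ q)
  fromMiddle-left s = either-↑ˡ _ _ s
  fromMiddle-zero : fromMiddle (p ↑ʳ zero) ≡ zero
  fromMiddle-zero = either-↑ʳ {p} _ _ zero
  fromMiddle-suc : ∀ g → fromMiddle (p ↑ʳ suc g) ≡ suc (p ↑ʳ g)
  fromMiddle-suc g = either-↑ʳ {p} _ _ (suc g)

  -- In the order [S, 0, R] the p + 1 leftmost columns vanish below row p.
  det-glued-leftColumn : ∀ (rR : Fin q → ℤ) (cS : Fin p → ℤ) →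
    det (suc (p ℕ.+ q)) (glued (+ 0) zeros rR cS zeros) ≡ + 0
  det-glued-leftColumn rR cS = trans (det-fromMiddle G)
    (det-zeroBlock (p ℕ.+ suc q) (λ a b → G (fromMiddle a) (fromMiddle b)) p (suc p) ℕP.≤-refl
      (subst (suc p ≤_) (sym (ℕP.+-suc p q)) (s≤s (ℕP.m≤m+n p q))) vanish)
    where
    G = glued (+ 0) zeros rR cS zeros
    vanish : ∀ i j → p ≤ toℕ i → toℕ j ℕ.< suc p → G (fromMiddle i) (fromMiddle j) ≡ + 0
    vanish i j p≤i j≤p with split p (suc q) i | split p (suc q) j
    ... | left s | _ = ⊥-elim (ℕP.<⇒≱ (subst (ℕ._< p) (sym (FP.toℕ-↑ˡ s (suc q))) (FP.toℕ<n s)) p≤i)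
    ... | right _ | right (suc g) =
      ⊥-elim (ℕP.<⇒≱ j≤p (subst (suc p ≤_) (sym (trans (FP.toℕ-↑ʳ p (suc g)) (ℕP.+-suc p (toℕ g))))
                                                (s≤s (ℕP.m≤m+n p (toℕ g)))))
    ... | right zero    | left s     = trans (cong₂ G fromMiddle-zero (fromMiddle-left s)) (either-↑ˡ zeros rR s)
    ... | right zero    | right zero = cong₂ G fromMiddle-zero fromMiddle-zero
    ... | right (suc g) | left s     = trans (cong₂ G (fromMiddle-suc g) (fromMiddle-left s)) (blockDiag-rl g s)
    ... | right (suc g) | right zero = trans (cong₂ G (fromMiddle-suc g) fromMiddle-zero) (either-↑ʳ {p} cS zeros g)

  -- In the order [S, 0, R] the matrix is block lower triangular.
  det-glued-rightColumn : ∀ (rR cR : Fin q → ℤ) →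
    det (suc (p ℕ.+ q)) (glued (+ 0) zeros rR zeros cR) ≡ det p A * det (suc q) (border (+ 0) rR cR D)
  det-glued-rightColumn rR cR = trans (det-fromMiddle G)
    (trans (det-lowerBlock p (suc q) (λ a b → G (fromMiddle a) (fromMiddle b)) upperRight≡0)
      (cong₂ _*_ (det-cong p upperLeft) (det-cong (suc q) lowerRight)))
    where
    G = glued (+ 0) zeros rR zeros cR
    upperRight≡0 : ∀ s t → G (fromMiddle (s ↑ˡ suc q)) (fromMiddle (p ↑ʳ t)) ≡ + 0
    upperRight≡0 s zero    = trans (cong₂ G (fromMiddle-left s) fromMiddle-zero) (either-↑ˡ zeros cR s)
    upperRight≡0 s (suc g) = trans (cong₂ G (fromMiddle-left s) (fromMiddle-suc g)) (blockDiag-lr s g)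
    upperLeft : ∀ s s' → G (fromMiddle (s ↑ˡ suc q)) (fromMiddle (s' ↑ˡ suc q)) ≡ A s s'
    upperLeft s s' = trans (cong₂ G (fromMiddle-left s) (fromMiddle-left s')) (blockDiag-ll s s')
    lowerRight : ∀ t t' → G (fromMiddle (p ↑ʳ t)) (fromMiddle (p ↑ʳ t')) ≡ border (+ 0) rR cR D t t'
    lowerRight zero    zero     = cong₂ G fromMiddle-zero fromMiddle-zero
    lowerRight zero    (suc g') = trans (cong₂ G fromMiddle-zero (fromMiddle-suc g')) (either-↑ʳ {p} zeros rR g')
    lowerRight (suc g) zero     = trans (cong₂ G (fromMiddle-suc g) fromMiddle-zero) (either-↑ʳ {p} zeros cR g)
    lowerRight (suc g) (suc g') = trans (cong₂ G (fromMiddle-suc g) (fromMiddle-suc g')) (blockDiag-rr g g')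

  det-glued-splitRow₀ : ∀ x rS rR cS cR → det (suc (p ℕ.+ q)) (glued x rS rR cS cR) ≡
    det (suc (p ℕ.+ q)) (glued x rS zeros cS cR) + det (suc (p ℕ.+ q)) (glued (+ 0) zeros rR cS cR)
  det-glued-splitRow₀ x rS rR cS cR =
    det-linear-row₀ (p ℕ.+ q) (glued x rS rR cS cR) (glued x rS zeros cS cR) (glued (+ 0) zeros rR cS cR)
      row₀ (sameRows {x} {x} {rS} {rR} {rS} {zeros}) (sameRows {x} {+ 0} {rS} {rR} {zeros} {rR})
    where
    row₀ : ∀ j → glued x rS rR cS cR zero j ≡ glued x rS zeros cS cR zero j + glued (+ 0) zeros rR cS cR zero j
    row₀ zero    = sym (ℤP.+-identityʳ x)
    row₀ (suc c) = either-split rS rR c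
    sameRows : ∀ {y y' r₁ r₂ r₁' r₂'} a b → glued y r₁ r₂ cS cR (suc a) b ≡ glued y' r₁' r₂' cS cR (suc a) b
    sameRows a zero    = refl
    sameRows a (suc b) = refl

  det-glued-splitCol₀ : ∀ rR cS cR → det (suc (p ℕ.+ q)) (glued (+ 0) zeros rR cS cR) ≡
    det (suc (p ℕ.+ q)) (glued (+ 0) zeros rR cS zeros) + det (suc (p ℕ.+ q)) (glued (+ 0) zeros rR zeros cR)
  det-glued-splitCol₀ rR cS cR =
    det-linear-col₀ (p ℕ.+ q) (glued (+ 0) zeros rR cS cR) (glued (+ 0) zeros rR cS zeros) (glued (+ 0) zeros rR zeros cR)
      col₀ (sameCols {cS} {cR} {cS} {zeros}) (sameCols {cS} {cR} {zeros} {cR})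
    where
    col₀ : ∀ i → glued (+ 0) zeros rR cS cR i zero ≡ glued (+ 0) zeros rR cS zeros i zero + glued (+ 0) zeros rR zeros cR i zero
    col₀ zero    = refl
    col₀ (suc c) = either-split cS cR c
    sameCols : ∀ {c₁ c₂ c₁' c₂'} a b → glued (+ 0) zeros rR c₁ c₂ a (suc b) ≡ glued (+ 0) zeros rR c₁' c₂' a (suc b)
    sameCols zero    b = refl
    sameCols (suc a) b = refl

  det-glued-upperRow : ∀ x rS cS cR → det (suc (p ℕ.+ q)) (glued x rS zeros cS cR) ≡ det (suc p) (border x rS cS A) * det q D
  det-glued-upperRow x rS cS cR =
    trans (det-lowerBlock (suc p) q (glued x rS zeros cS cR) upperRight≡0)
          (cong₂ _*_ (det-cong (suc p) upperLeft) (det-cong q blockDiag-rr))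
    where
    upperRight≡0 : ∀ i j → glued x rS zeros cS cR (i ↑ˡ q) (suc p ↑ʳ j) ≡ + 0
    upperRight≡0 zero    j = either-↑ʳ {p} rS zeros j
    upperRight≡0 (suc s) j = blockDiag-lr s j
    upperLeft : ∀ i j → glued x rS zeros cS cR (i ↑ˡ q) (j ↑ˡ q) ≡ border x rS cS A i j
    upperLeft zero    zero     = refl
    upperLeft zero    (suc s)  = either-↑ˡ rS zeros s
    upperLeft (suc s) zero     = either-↑ˡ cS cR s
    upperLeft (suc s) (suc s') = blockDiag-ll s s'

  det-glued : ∀ x rS rR cS cR → det (suc (p ℕ.+ q)) (glued x rS rR cS cR) ≡
    det (suc p) (border x rS cS A) * det q D + det p A * (det (suc q) (border x rR cR D) - x * det q D)
  det-glued x rS rR cS cR = begin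
      det (suc (p ℕ.+ q)) (glued x rS rR cS cR)
    ≡⟨ det-glued-splitRow₀ x rS rR cS cR ⟩
      det (suc (p ℕ.+ q)) (glued x rS zeros cS cR) + det (suc (p ℕ.+ q)) (glued (+ 0) zeros rR cS cR)
    ≡⟨ cong₂ _+_ (det-glued-upperRow x rS cS cR) (det-glued-splitCol₀ rR cS cR) ⟩
      dT * det q D + (det (suc (p ℕ.+ q)) (glued (+ 0) zeros rR cS zeros) + det (suc (p ℕ.+ q)) (glued (+ 0) zeros rR zeros cR))
    ≡⟨ cong₂ (λ u v → dT * det q D + (u + v)) (det-glued-leftColumn rR cS) (det-glued-rightColumn rR cR) ⟩
      dT * det q D + (+ 0 + det p A * det (suc q) (border (+ 0) rR cR D))
    ≡⟨ cong (λ d → dT * det q D + (+ 0 + det p A * d)) (det-border-zeroCorner q x rR cR D) ⟩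
      dT * det q D + (+ 0 + det p A * (det (suc q) (border x rR cR D) - x * det q D))
    ≡⟨ cong (_+_ (dT * det q D)) (ℤP.+-identityˡ _) ⟩
      dT * det q D + det p A * (det (suc q) (border x rR cR D) - x * det q D) ∎
    where
    open ≡-Reasoning
    dT = det (suc p) (border x rS cS A)

-- Characteristic matrices of coalescences

charMatrix : ∀ {n} → Adj n → ℤ → Mat n
charMatrix A x i j = (if ⌊ i ≟ j ⌋ then x else + 0) - (if A i j then + 1 else + 0)

⌊≟⌋-cong : ∀ {k l} (a b : Fin k) (c d : Fin l) → (a ≡ b → c ≡ d) → (c ≡ d → a ≡ b) → ⌊ a ≟ b ⌋ ≡ ⌊ c ≟ d ⌋
⌊≟⌋-cong a b c d ⇒ ⇐ with a ≟ b | c ≟ d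
... | yes _   | yes _   = refl
... | no _    | no _    = refl
... | yes a≡b | no c≢d  = ⊥-elim (c≢d (⇒ a≡b))
... | no a≢b  | yes c≡d = ⊥-elim (a≢b (⇐ c≡d))

⌊≟⌋-refl : ∀ {k} (a : Fin k) → ⌊ a ≟ a ⌋ ≡ true
⌊≟⌋-refl a with a ≟ a
... | yes _   = refl
... | no a≢a = ⊥-elim (a≢a refl)

⌊≟⌋-≢ : ∀ {k} (a b : Fin k) → a ≢ b → ⌊ a ≟ b ⌋ ≡ false
⌊≟⌋-≢ a b a≢b with a ≟ b
... | yes a≡b = ⊥-elim (a≢b a≡b)
... | no _    = refl

↑ˡ≢↑ʳ : ∀ {n m} (t : Fin n) (g : Fin m) → t ↑ˡ m ≢ n ↑ʳ g
↑ˡ≢↑ʳ {n} {m} t g eq with trans (sym (FP.splitAt-↑ˡ n t m)) (trans (cong (splitAt n) eq) (FP.splitAt-↑ʳ n m g))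
... | ()

charMatrix-reindex : ∀ {n k} (A : Adj n) x (f : Fin k → Fin n) → (∀ a b → f a ≡ f b → a ≡ b) → ∀ a b →
  charMatrix (λ i j → A (f i) (f j)) x a b ≡ charMatrix A x (f a) (f b)
charMatrix-reindex A x f f-inj a b =
  cong (λ v → (if v then x else + 0) - (if A (f a) (f b) then + 1 else + 0)) (⌊≟⌋-cong a b (f a) (f b) (cong f) (f-inj a b))

charMatrix-diagonal : ∀ {k} (A : Adj k) x v → A v v ≡ false → charMatrix A x v v ≡ x
charMatrix-diagonal A x v Avv≡false rewrite ⌊≟⌋-refl v | Avv≡false = ℤP.+-identityʳ x

-- Vertices of T are t ↑ˡ m; the non-root vertices of G are n ↑ʳ g, standing for punchIn r g.
module CoalesceEntries {n m} (T : Adj n) (u : Fin n) (G : Adj (suc m)) (r : Fin (suc m)) where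

  C : Adj (n ℕ.+ m)
  C = coalesce T u G r

  private
    tImage-↑ˡ : ∀ t → tImage {n} {m} (t ↑ˡ m) ≡ just t
    tImage-↑ˡ t rewrite FP.splitAt-↑ˡ n t m = refl
    tImage-↑ʳ : ∀ g → tImage {n} {m} (n ↑ʳ g) ≡ nothing
    tImage-↑ʳ g rewrite FP.splitAt-↑ʳ n m g = refl
    gImage-↑ˡ : ∀ t → gImage {n} {m} u r (t ↑ˡ m) ≡ (if ⌊ t ≟ u ⌋ then just r else nothing)
    gImage-↑ˡ t rewrite FP.splitAt-↑ˡ n t m = refl
    gImage-↑ʳ : ∀ g → gImage {n} {m} u r (n ↑ʳ g) ≡ just (punchIn r g)
    gImage-↑ʳ g rewrite FP.splitAt-↑ʳ n m g = refl

  coalesce-ll : G r r ≡ false → ∀ t t' → C (t ↑ˡ m) (t' ↑ˡ m) ≡ T t t'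
  coalesce-ll Grr≡false t t' rewrite tImage-↑ˡ t | tImage-↑ˡ t' | gImage-↑ˡ t | gImage-↑ˡ t' with ⌊ t ≟ u ⌋ | ⌊ t' ≟ u ⌋
  ... | true  | true rewrite Grr≡false = ∨-identityʳ (T t t')
  ... | true  | false = ∨-identityʳ (T t t')
  ... | false | true  = ∨-identityʳ (T t t')
  ... | false | false = ∨-identityʳ (T t t')

  coalesce-lr : ∀ t g → C (t ↑ˡ m) (n ↑ʳ g) ≡ (if ⌊ t ≟ u ⌋ then G r (punchIn r g) else false)
  coalesce-lr t g rewrite tImage-↑ˡ t | tImage-↑ʳ g | gImage-↑ˡ t | gImage-↑ʳ g with ⌊ t ≟ u ⌋
  ... | true  = refl
  ... | false = refl

  coalesce-rl : ∀ g t → C (n ↑ʳ g) (t ↑ˡ m) ≡ (if ⌊ t ≟ u ⌋ then G (punchIn r g) r else false)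
  coalesce-rl g t rewrite tImage-↑ˡ t | tImage-↑ʳ g | gImage-↑ˡ t | gImage-↑ʳ g with ⌊ t ≟ u ⌋
  ... | true  = refl
  ... | false = refl

  coalesce-rr : ∀ g g' → C (n ↑ʳ g) (n ↑ʳ g') ≡ G (punchIn r g) (punchIn r g')
  coalesce-rr g g' rewrite tImage-↑ʳ g | gImage-↑ʳ g | gImage-↑ʳ g' = refl

  module _ (x : ℤ) where

    charMatrix-ll : G r r ≡ false → ∀ t t' → charMatrix C x (t ↑ˡ m) (t' ↑ˡ m) ≡ charMatrix T x t t'
    charMatrix-ll Grr≡false t t' = cong₂ (λ v w → (if v then x else + 0) - (if w then + 1 else + 0))
      (⌊≟⌋-cong _ _ t t' (FP.↑ˡ-injective m t t') (cong (_↑ˡ m))) (coalesce-ll Grr≡false t t')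

    charMatrix-rr : ∀ g g' → charMatrix C x (n ↑ʳ g) (n ↑ʳ g') ≡ charMatrix G x (punchIn r g) (punchIn r g')
    charMatrix-rr g g' = cong₂ (λ v w → (if v then x else + 0) - (if w then + 1 else + 0))
      (⌊≟⌋-cong _ _ (punchIn r g) (punchIn r g') (cong (punchIn r) ∘ FP.↑ʳ-injective n g g')
                   (cong (n ↑ʳ_) ∘ FP.punchIn-injective r g g'))
      (coalesce-rr g g')

    charMatrix-ur : ∀ g → charMatrix C x (u ↑ˡ m) (n ↑ʳ g) ≡ charMatrix G x r (punchIn r g)
    charMatrix-ur g = cong₂ (λ v w → (if v then x else + 0) - (if w then + 1 else + 0))
      (trans (⌊≟⌋-≢ _ _ (↑ˡ≢↑ʳ u g)) (sym (⌊≟⌋-≢ r (punchIn r g) (FP.punchInᵢ≢i r g ∘ sym))))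
      (trans (coalesce-lr u g) (cong (λ v → if v then G r (punchIn r g) else false) (⌊≟⌋-refl u)))

    charMatrix-ru : ∀ g → charMatrix C x (n ↑ʳ g) (u ↑ˡ m) ≡ charMatrix G x (punchIn r g) r
    charMatrix-ru g = cong₂ (λ v w → (if v then x else + 0) - (if w then + 1 else + 0))
      (trans (⌊≟⌋-≢ _ _ (↑ˡ≢↑ʳ u g ∘ sym)) (sym (⌊≟⌋-≢ (punchIn r g) r (FP.punchInᵢ≢i r g))))
      (trans (coalesce-rl g u) (cong (λ v → if v then G (punchIn r g) r else false) (⌊≟⌋-refl u)))

    charMatrix-lr : ∀ t g → t ≢ u → charMatrix C x (t ↑ˡ m) (n ↑ʳ g) ≡ + 0
    charMatrix-lr t g t≢u
      rewrite ⌊≟⌋-≢ (t ↑ˡ m) (n ↑ʳ g) (↑ˡ≢↑ʳ t g) | coalesce-lr t g | ⌊≟⌋-≢ t u t≢u = refl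

    charMatrix-rl : ∀ g t → t ≢ u → charMatrix C x (n ↑ʳ g) (t ↑ˡ m) ≡ + 0
    charMatrix-rl g t t≢u
      rewrite ⌊≟⌋-≢ (n ↑ʳ g) (t ↑ˡ m) (↑ˡ≢↑ʳ t g ∘ sym) | coalesce-rl g t | ⌊≟⌋-≢ t u t≢u = refl

deletedCharMatrix : ∀ {n} → Adj (suc n) → Fin (suc n) → ℤ → Mat n
deletedCharMatrix A r x i j = charMatrix A x (punchIn r i) (punchIn r j)

-- Rotating u to the front turns the coalescence into the glued matrix of Glued.
det-charMatrix-coalesce : ∀ p m (T : Adj (suc p)) (u : Fin (suc p)) (G : Adj (suc m)) (r : Fin (suc m)) x →
  T u u ≡ false → G r r ≡ false →
  det (suc p ℕ.+ m) (charMatrix (coalesce T u G r) x) ≡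
    det (suc p) (charMatrix T x) * det m (deletedCharMatrix G r x)
    + det p (deletedCharMatrix T u x) * (det (suc m) (charMatrix G x) - x * det m (deletedCharMatrix G r x))
det-charMatrix-coalesce p m T u G r x Tuu≡false Grr≡false = begin
    det (suc (p ℕ.+ m)) (charMatrix C x)
  ≡⟨ sym (detInvariant-rotate (p ℕ.+ m) (u ↑ˡ m) (charMatrix C x)) ⟩
    det (suc (p ℕ.+ m)) (λ a b → charMatrix C x (ρ a) (ρ b))
  ≡⟨ det-cong (suc (p ℕ.+ m)) rotated≡glued ⟩
    det (suc (p ℕ.+ m)) (glued x rS rR cS cR)
  ≡⟨ det-glued x rS rR cS cR ⟩
    det (suc p) (border x rS cS A) * det m D + det p A * (det (suc m) (border x rR cR D) - x * det m D)
  ≡⟨ cong₂ (λ a b → a * det m D + det p A * (b - x * det m D))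
       (trans (det-cong (suc p) (border≡rotated T u Tuu≡false)) (detInvariant-rotate p u (charMatrix T x)))
       (trans (det-cong (suc m) (border≡rotated G r Grr≡false)) (detInvariant-rotate m r (charMatrix G x))) ⟩
    det (suc p) (charMatrix T x) * det m D + det p A * (det (suc m) (charMatrix G x) - x * det m D) ∎
  where
  open ≡-Reasoning
  open CoalesceEntries T u G r
  A = deletedCharMatrix T u x
  D = deletedCharMatrix G r x
  open Glued p m A D
  rS = λ s → charMatrix T x u (punchIn u s)
  cS = λ s → charMatrix T x (punchIn u s) u
  rR = λ g → charMatrix G x r (punchIn r g)
  cR = λ g → charMatrix G x (punchIn r g) r
  ρ = rotate {p ℕ.+ m} (u ↑ˡ m)
  border≡rotated : ∀ {k} (H : Adj (suc k)) v → H v v ≡ false → ∀ a b →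
    border x (λ s → charMatrix H x v (punchIn v s)) (λ s → charMatrix H x (punchIn v s) v) (deletedCharMatrix H v x) a b
      ≡ charMatrix H x (rotate v a) (rotate v b)
  border≡rotated H v Hvv≡false zero    zero    = sym (charMatrix-diagonal H x v Hvv≡false)
  border≡rotated H v Hvv≡false zero    (suc j) = refl
  border≡rotated H v Hvv≡false (suc i) zero    = refl
  border≡rotated H v Hvv≡false (suc i) (suc j) = refl
  rotated≡glued : ∀ a b → charMatrix C x (ρ a) (ρ b) ≡ glued x rS rR cS cR a b
  rotated≡glued zero zero = trans (charMatrix-ll x Grr≡false u u) (charMatrix-diagonal T x u Tuu≡false)
  rotated≡glued zero (suc c) with split p m c
  ... | left s  = trans (cong (charMatrix C x (u ↑ˡ m)) (punchIn-↑ˡ u s m))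
                    (trans (charMatrix-ll x Grr≡false u (punchIn u s)) (sym (either-↑ˡ rS rR s)))
  ... | right g = trans (cong (charMatrix C x (u ↑ˡ m)) (punchIn-↑ʳ u m g))
                    (trans (charMatrix-ur x g) (sym (either-↑ʳ {p} rS rR g)))
  rotated≡glued (suc c) zero with split p m c
  ... | left s  = trans (cong (λ v → charMatrix C x v (u ↑ˡ m)) (punchIn-↑ˡ u s m))
                    (trans (charMatrix-ll x Grr≡false (punchIn u s) u) (sym (either-↑ˡ cS cR s)))
  ... | right g = trans (cong (λ v → charMatrix C x v (u ↑ˡ m)) (punchIn-↑ʳ u m g))
                    (trans (charMatrix-ru x g) (sym (either-↑ʳ {p} cS cR g)))
  rotated≡glued (suc c) (suc c') with split p m c | split p m c'
  ... | left s  | left s'  = trans (cong₂ (charMatrix C x) (punchIn-↑ˡ u s m) (punchIn-↑ˡ u s' m))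
                               (trans (charMatrix-ll x Grr≡false (punchIn u s) (punchIn u s')) (sym (blockDiag-ll s s')))
  ... | left s  | right g  = trans (cong₂ (charMatrix C x) (punchIn-↑ˡ u s m) (punchIn-↑ʳ u m g))
                               (trans (charMatrix-lr x (punchIn u s) g (FP.punchInᵢ≢i u s)) (sym (blockDiag-lr s g)))
  ... | right g | left s   = trans (cong₂ (charMatrix C x) (punchIn-↑ʳ u m g) (punchIn-↑ˡ u s m))
                               (trans (charMatrix-rl x g (punchIn u s) (FP.punchInᵢ≢i u s)) (sym (blockDiag-rl g s)))
  ... | right g | right g' = trans (cong₂ (charMatrix C x) (punchIn-↑ʳ u m g) (punchIn-↑ʳ u m g'))
                               (trans (charMatrix-rr x g g') (sym (blockDiag-rr g g')))

-- Induced subgraphs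

filterᵇ-cong : ∀ {A : Set} (p q : A → Bool) → (∀ v → p v ≡ q v) → ∀ xs → filterᵇ p xs ≡ filterᵇ q xs
filterᵇ-cong p q p≗q = LP.filter-≐ (T? ∘ p) (T? ∘ q) ((λ {v} → subst Bool.T (p≗q v)) , (λ {v} → subst Bool.T (sym (p≗q v))))

filterᵇ-all : ∀ {A : Set} (p : A → Bool) xs → All (λ v → p v ≡ true) xs → filterᵇ p xs ≡ xs
filterᵇ-all p xs all-true = LP.filter-all (T? ∘ p) (All.map (λ pv≡true → subst Bool.T (sym pv≡true) tt) all-true)

filterᵇ-map : ∀ {A B : Set} (p : B → Bool) (f : A → B) xs → filterᵇ p (map f xs) ≡ map f (filterᵇ (p ∘ f) xs)
filterᵇ-map p f []       = refl
filterᵇ-map p f (x ∷ xs) with p (f x)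
... | true  = cong (f x ∷_) (filterᵇ-map p f xs)
... | false = filterᵇ-map p f xs

filterᵇ-filterᵇ : ∀ {A : Set} (p q : A → Bool) xs → filterᵇ p (filterᵇ q xs) ≡ filterᵇ (λ v → q v ∧ p v) xs
filterᵇ-filterᵇ p q []       = refl
filterᵇ-filterᵇ p q (x ∷ xs) with q x
... | false = filterᵇ-filterᵇ p q xs
... | true with p x
...   | true  = cong (x ∷_) (filterᵇ-filterᵇ p q xs)
...   | false = filterᵇ-filterᵇ p q xs

tabulate-↑ : ∀ {A : Set} n m (h : Fin (n ℕ.+ m) → A) → tabulate h ≡ tabulate (h ∘ (_↑ˡ m)) ++ tabulate (h ∘ (n ↑ʳ_))
tabulate-↑ zero    m h = refl
tabulate-↑ (suc n) m h = cong (h zero ∷_) (tabulate-↑ n m (h ∘ suc))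

charPoly-induced : ∀ (G : Graph) {k} (f : Fin k → Fin (size G)) L → L ≡ tabulate f → ∀ x →
  charPoly (induced G L) x ≡ det k (charMatrix (λ i j → adj G (f i) (f j)) x)
charPoly-induced G f L refl x = trans (det-cast e (charMatrix (adj (induced G (tabulate f))) x)) (det-cong _ entry≡)
  where
  e = LP.length-tabulate f
  cast-injective : ∀ a b → cast (sym e) a ≡ cast (sym e) b → a ≡ b
  cast-injective a b eq = FP.toℕ-injective (trans (sym (FP.toℕ-cast (sym e) a)) (trans (cong toℕ eq) (FP.toℕ-cast (sym e) b)))
  entry≡ : ∀ a b → charMatrix (adj (induced G (tabulate f))) x (cast (sym e) a) (cast (sym e) b)
                  ≡ charMatrix (λ i j → adj G (f i) (f j)) x a b
  entry≡ a b = cong₂ (λ v w → (if v then x else + 0) - (if w then + 1 else + 0))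
    (⌊≟⌋-cong _ _ a b (cast-injective a b) (cong (cast (sym e))))
    (cong₂ (adj G) (LP.lookup-tabulate f a) (LP.lookup-tabulate f b))

filterᵇ-allFin-≢ : ∀ k (r : Fin (suc k)) → filterᵇ (λ v → not ⌊ v ≟ r ⌋) (allFin (suc k)) ≡ tabulate (punchIn r)
filterᵇ-allFin-≢ k       zero    = filterᵇ-all _ (tabulate suc) (AllP.tabulate⁺ (λ i → refl))
filterᵇ-allFin-≢ (suc k) (suc r) = cong (zero ∷_) (begin
    filterᵇ keep (tabulate suc)
  ≡⟨ cong (filterᵇ keep) (sym (LP.map-tabulate id suc)) ⟩
    filterᵇ keep (map suc (allFin (suc k)))
  ≡⟨ filterᵇ-map keep suc (allFin (suc k)) ⟩
    map suc (filterᵇ (keep ∘ suc) (allFin (suc k)))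
  ≡⟨ cong (map suc) (filterᵇ-cong (keep ∘ suc) (λ v → not ⌊ v ≟ r ⌋)
       (λ v → cong not (⌊≟⌋-cong (suc v) (suc r) v r FP.suc-injective (cong suc))) (allFin (suc k))) ⟩
    map suc (filterᵇ (λ v → not ⌊ v ≟ r ⌋) (allFin (suc k)))
  ≡⟨ cong (map suc) (filterᵇ-allFin-≢ k r) ⟩
    map suc (tabulate (punchIn r))
  ≡⟨ LP.map-tabulate (punchIn r) suc ⟩
    tabulate (suc ∘ punchIn r) ∎)
  where
  open ≡-Reasoning
  keep : Fin (suc (suc k)) → Bool
  keep v = not ⌊ v ≟ suc r ⌋

charPoly-deleteVertex : ∀ m (G : Adj (suc m)) r x →
  charPoly (deleteVertex (mkGraph (suc m) G) r) x ≡ det m (deletedCharMatrix G r x)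
charPoly-deleteVertex m G r x = trans (charPoly-induced (mkGraph (suc m) G) (punchIn r) _ (filterᵇ-allFin-≢ m r) x)
  (det-cong m (charMatrix-reindex G x (punchIn r) (FP.punchIn-injective r)))

all-lookup : ∀ {A : Set} {P : A → Set} {xs} → All P xs → ∀ i → P (List.lookup xs i)
all-lookup (px ∷ pxs) zero    = px
all-lookup (px ∷ pxs) (suc i) = all-lookup pxs i

unique-lookup-injective : ∀ {A : Set} (xs : List A) → Unique xs → ∀ i j → List.lookup xs i ≡ List.lookup xs j → i ≡ j
unique-lookup-injective (x ∷ xs) (x∉xs ∷ uniq) zero    zero    eq = refl
unique-lookup-injective (x ∷ xs) (x∉xs ∷ uniq) zero    (suc j) eq = ⊥-elim (all-lookup x∉xs j eq)
unique-lookup-injective (x ∷ xs) (x∉xs ∷ uniq) (suc i) zero    eq = ⊥-elim (all-lookup x∉xs i (sym eq))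
unique-lookup-injective (x ∷ xs) (x∉xs ∷ uniq) (suc i) (suc j) eq = cong suc (unique-lookup-injective xs uniq i j eq)

filterᵇ-≢-lookup : ∀ {n} (x : Fin n) xs (w : Fin (suc (length xs))) → Unique (x ∷ xs) →
  filterᵇ (λ v → not ⌊ v ≟ List.lookup (x ∷ xs) w ⌋) (x ∷ xs) ≡ tabulate (λ i → List.lookup (x ∷ xs) (punchIn w i))
filterᵇ-≢-lookup x xs zero (x∉xs ∷ uniq) rewrite ⌊≟⌋-refl x =
  trans (filterᵇ-all _ xs (All.map (λ x≢v → cong not (⌊≟⌋-≢ _ x (x≢v ∘ sym))) x∉xs)) (sym (LP.tabulate-lookup xs))
filterᵇ-≢-lookup x (y ∷ ys) (suc w) (x∉xs ∷ uniq) rewrite ⌊≟⌋-≢ x (List.lookup (y ∷ ys) w) (all-lookup x∉xs w) =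
  cong (x ∷_) (filterᵇ-≢-lookup y ys w uniq)

-- Schwenk's formula and rooted powers

charPoly-coalesce : ∀ (H : Graph) (u : Fin (size H)) {m} (G : Adj (suc m)) r x → adj H u u ≡ false → G r r ≡ false →
  charPoly (mkGraph (size H ℕ.+ m) (coalesce (adj H) u G r)) x ≡
    charPoly H x * charPoly (deleteVertex (mkGraph (suc m) G) r) x
    + charPoly (deleteVertex H u) x
      * (charPoly (mkGraph (suc m) G) x - x * charPoly (deleteVertex (mkGraph (suc m) G) r) x)
charPoly-coalesce (mkGraph (suc p) T) u {m} G r x Tuu≡false Grr≡false =
  trans (det-charMatrix-coalesce p m T u G r x Tuu≡false Grr≡false)
    (cong₂ (λ d a → det (suc p) (charMatrix T x) * d + a * (det (suc m) (charMatrix G x) - x * d))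
      (sym (charPoly-deleteVertex m G r x)) (sym (charPoly-deleteVertex p T u x)))

module RootedPower {m} (G : Adj (suc m)) (r : Fin (suc m)) (Grr≡false : G r r ≡ false) (x : ℤ) where

  R Q : ℤ
  R = charPoly (deleteVertex (mkGraph (suc m) G) r) x
  Q = charPoly (mkGraph (suc m) G) x - x * R

  rootedPower-loopless : ∀ a → rootedPower G r a zero zero ≡ false
  rootedPower-loopless zero    = refl
  rootedPower-loopless (suc a) =
    trans (CoalesceEntries.coalesce-ll (rootedPower G r a) zero G r Grr≡false zero zero) (rootedPower-loopless a)

  -- Without its root, G^(a) is the disjoint union of a copies of G − r.
  charPoly-rootedPower-deleteRoot : ∀ a → charPoly (deleteVertex (mkGraph _ (rootedPower G r a)) zero) x ≡ R ^ a
  charPoly-rootedPower-deleteRoot zero    = refl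
  charPoly-rootedPower-deleteRoot (suc a) = begin
      charPoly (deleteVertex (mkGraph _ C) zero) x
    ≡⟨ charPoly-deleteVertex (n ℕ.+ m) C zero x ⟩
      det (n ℕ.+ m) (deletedCharMatrix C zero x)
    ≡⟨ det-lowerBlock n m (deletedCharMatrix C zero x) (λ i j → charMatrix-lr x (suc i) j (λ ())) ⟩
      det n (λ i j → charMatrix C x (suc i ↑ˡ m) (suc j ↑ˡ m)) * det m (λ i j → charMatrix C x (suc n ↑ʳ i) (suc n ↑ʳ j))
    ≡⟨ cong₂ _*_ (det-cong n (λ i j → charMatrix-ll x Grr≡false (suc i) (suc j))) (det-cong m (charMatrix-rr x)) ⟩
      det n (deletedCharMatrix (rootedPower G r a) zero x) * det m (deletedCharMatrix G r x)
    ≡⟨ cong₂ _*_ (trans (sym (charPoly-deleteVertex n (rootedPower G r a) zero x)) (charPoly-rootedPower-deleteRoot a))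
                 (sym (charPoly-deleteVertex m G r x)) ⟩
      R ^ a * R
    ≡⟨ ℤP.*-comm (R ^ a) R ⟩
      R ^ suc a ∎
    where
    open ≡-Reasoning
    n = powSize m a
    open CoalesceEntries (rootedPower G r a) zero G r

  charPoly-rootedPower : ∀ a → charPoly (mkGraph _ (rootedPower G r a)) x ≡ x * R ^ a + (+ a) * Q * R ^ (a ∸ 1)
  charPoly-rootedPower zero = base x Q
    where
    base : ∀ x Q → + 1 * ((x - + 0) * + 1) + + 0 ≡ x * + 1 + + 0 * Q * + 1
    base = solve-∀
  charPoly-rootedPower (suc a) =
    trans (charPoly-coalesce (mkGraph _ (rootedPower G r a)) zero G r x (rootedPower-loopless a) Grr≡false)
      (trans (cong₂ (λ P P⁻ → P * R + P⁻ * Q) (charPoly-rootedPower a) (charPoly-rootedPower-deleteRoot a)) (step a))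
    where
    step : ∀ a → (x * R ^ a + (+ a) * Q * R ^ (a ∸ 1)) * R + R ^ a * Q ≡ x * R ^ suc a + (+ suc a) * Q * R ^ a
    step zero = identity x Q R
      where
      identity : ∀ x Q R → (x * + 1 + + 0 * Q * + 1) * R + + 1 * Q ≡ x * (R * + 1) + + 1 * Q * + 1
      identity = solve-∀
    step (suc b) = identity x Q R (R ^ b) (+ suc b)
      where
      identity : ∀ x Q R Rᵇ s → (x * (R * Rᵇ) + s * Q * Rᵇ) * R + R * Rᵇ * Q ≡ x * (R * (R * Rᵇ)) + (+ 1 + s) * Q * (R * Rᵇ)
      identity = solve-∀

-- Multiple coalescences

anyFin-false : ∀ k (p : Fin k → Bool) → (∀ i → p i ≡ false) → anyFin k p ≡ false
anyFin-false zero    p all-false = refl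
anyFin-false (suc k) p all-false rewrite all-false zero = anyFin-false k (p ∘ suc) (all-false ∘ suc)

anyFin-cong : ∀ k (p q : Fin k → Bool) → (∀ i → p i ≡ q i) → anyFin k p ≡ anyFin k q
anyFin-cong zero    p q p≗q = refl
anyFin-cong (suc k) p q p≗q = cong₂ _∨_ (p≗q zero) (anyFin-cong k (p ∘ suc) (q ∘ suc) (p≗q ∘ suc))

not-∨ : ∀ a b → not (a ∨ b) ≡ not b ∧ not a
not-∨ true  true  = refl
not-∨ true  false = refl
not-∨ false true  = refl
not-∨ false false = refl

-- Deleting the vertices u (suc i), i ∈ I, from T(u₀ = 0)H gives H coalesced into
-- T − {u (suc i) : i ∈ I} at the position ũ that u₀ takes there.
module DeleteAfterCoalesce (k : ℕ) (T : Graph) (u : Fin (suc k) → Fin (size T)) (u-inj : ∀ i j → u i ≡ u j → i ≡ j)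
                           (T-loopless : ∀ i → adj T (u i) (u i) ≡ false) {M : ℕ} (H : Adj (suc M))
                           (H-loopless : H zero zero ≡ false) (x : ℤ) (I : Subset k) where

  n = size T

  T' : Graph
  T' = mkGraph (n ℕ.+ M) (coalesce (adj T) (u zero) H zero)

  u' : Fin k → Fin (n ℕ.+ M)
  u' i = u (suc i) ↑ˡ M

  Tout Tin : Graph
  Tout = deleteImage T u (outside ∷ I)
  Tin  = deleteImage T u (inside ∷ I)

  removedOut keepOut : Fin n → Bool
  removedOut v = anyFin k (λ i → lookup I i ∧ ⌊ u (suc i) ≟ v ⌋)
  keepOut v = not (removedOut v)

  Lout : List (Fin n)
  Lout = filterᵇ keepOut (allFin n)

  unique-Lout : Unique Lout
  unique-Lout = UniqueP.filter⁺ (T? ∘ keepOut) (UniqueP.allFin⁺ n)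

  keepOut-u₀ : keepOut (u zero) ≡ true
  keepOut-u₀ = cong not (anyFin-false k _ λ i →
    trans (cong (lookup I i ∧_) (⌊≟⌋-≢ _ _ (λ eq → suc≢zero (u-inj _ _ eq)))) (∧-zeroʳ _))
    where
    suc≢zero : ∀ {i : Fin k} → suc i ≢ zero
    suc≢zero ()

  u₀∈Lout : u zero ∈ Lout
  u₀∈Lout = ∈-filter⁺ (T? ∘ keepOut) (∈-allFin (u zero)) (subst Bool.T (sym keepOut-u₀) tt)

  ũ : Fin (length Lout)
  ũ = index u₀∈Lout

  lookup-ũ : List.lookup Lout ũ ≡ u zero
  lookup-ũ = sym (lookup-index u₀∈Lout)

  keep' : Fin (n ℕ.+ M) → Bool
  keep' v = not (anyFin k (λ i → lookup I i ∧ ⌊ u' i ≟ v ⌋))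

  -- T' − {u'_i : i ∈ I} lists the kept vertices of T, then all vertices of H − 0.
  vertexOf : Fin (length Lout ℕ.+ M) → Fin (n ℕ.+ M)
  vertexOf = either (λ a → List.lookup Lout a ↑ˡ M) (n ↑ʳ_)

  kept-T' : filterᵇ keep' (allFin (n ℕ.+ M)) ≡ tabulate vertexOf
  kept-T' = begin
      filterᵇ keep' (tabulate id)
    ≡⟨ cong (filterᵇ keep') (tabulate-↑ n M id) ⟩
      filterᵇ keep' (tabulate (_↑ˡ M) ++ tabulate (n ↑ʳ_))
    ≡⟨ LP.filter-++ (T? ∘ keep') (tabulate (_↑ˡ M)) (tabulate (n ↑ʳ_)) ⟩
      filterᵇ keep' (tabulate (_↑ˡ M)) ++ filterᵇ keep' (tabulate (n ↑ʳ_))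
    ≡⟨ cong₂ _++_ kept-T (filterᵇ-all keep' (tabulate (n ↑ʳ_)) (AllP.tabulate⁺ kept-H)) ⟩
      tabulate (λ a → List.lookup Lout a ↑ˡ M) ++ tabulate (n ↑ʳ_)
    ≡⟨ sym (trans (tabulate-↑ (length Lout) M vertexOf)
                  (cong₂ _++_ (LP.tabulate-cong (either-↑ˡ (λ a → List.lookup Lout a ↑ˡ M) (n ↑ʳ_)))
                               (LP.tabulate-cong (either-↑ʳ {length Lout} (λ a → List.lookup Lout a ↑ˡ M) (n ↑ʳ_))))) ⟩
      tabulate vertexOf ∎
    where
    open ≡-Reasoning
    kept-H : ∀ g → keep' (n ↑ʳ g) ≡ true
    kept-H g = cong not (anyFin-false k _ λ i →
      trans (cong (lookup I i ∧_) (⌊≟⌋-≢ _ _ (↑ˡ≢↑ʳ (u (suc i)) g))) (∧-zeroʳ _))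
    kept-T : filterᵇ keep' (tabulate (_↑ˡ M)) ≡ tabulate (λ a → List.lookup Lout a ↑ˡ M)
    kept-T = begin
        filterᵇ keep' (tabulate (_↑ˡ M))
      ≡⟨ cong (filterᵇ keep') (sym (LP.map-tabulate id (_↑ˡ M))) ⟩
        filterᵇ keep' (map (_↑ˡ M) (allFin n))
      ≡⟨ filterᵇ-map keep' (_↑ˡ M) (allFin n) ⟩
        map (_↑ˡ M) (filterᵇ (keep' ∘ (_↑ˡ M)) (allFin n))
      ≡⟨ cong (map (_↑ˡ M)) (filterᵇ-cong _ keepOut (λ t → cong not (anyFin-cong k _ _ λ i →
           cong (lookup I i ∧_) (⌊≟⌋-cong _ _ _ _ (FP.↑ˡ-injective M (u (suc i)) t) (cong (_↑ˡ M))))) (allFin n)) ⟩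
        map (_↑ˡ M) Lout
      ≡⟨ cong (map (_↑ˡ M)) (sym (LP.tabulate-lookup Lout)) ⟩
        map (_↑ˡ M) (tabulate (List.lookup Lout))
      ≡⟨ LP.map-tabulate (List.lookup Lout) (_↑ˡ M) ⟩
        tabulate (λ a → List.lookup Lout a ↑ˡ M) ∎

  charPoly-T'-deleteImage : charPoly (deleteImage T' u' I) x ≡
    charPoly (mkGraph (length Lout ℕ.+ M) (coalesce (adj Tout) ũ H zero)) x
  charPoly-T'-deleteImage = trans (charPoly-induced T' vertexOf _ kept-T' x)
    (det-cong _ (λ a b → cong (λ w → (if ⌊ a ≟ b ⌋ then x else + 0) - (if w then + 1 else + 0)) (adj≡ a b)))
    where
    module E₁ = CoalesceEntries (adj T) (u zero) H zero
    module E₂ = CoalesceEntries (adj Tout) ũ H zero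
    is-u₀ : ∀ s → ⌊ List.lookup Lout s ≟ u zero ⌋ ≡ ⌊ s ≟ ũ ⌋
    is-u₀ s = ⌊≟⌋-cong _ _ _ _ (λ eq → unique-lookup-injective Lout unique-Lout s ũ (trans eq (sym lookup-ũ)))
                                (λ eq → trans (cong (List.lookup Lout) eq) lookup-ũ)
    adj≡ : ∀ a b → E₁.C (vertexOf a) (vertexOf b) ≡ E₂.C a b
    adj≡ a b with split (length Lout) M a | split (length Lout) M b
    ... | left s  | left s'  = trans (cong₂ E₁.C (either-↑ˡ _ _ s) (either-↑ˡ _ _ s'))
                                 (trans (E₁.coalesce-ll H-loopless _ _) (sym (E₂.coalesce-ll H-loopless s s')))
    ... | left s  | right g  = trans (cong₂ E₁.C (either-↑ˡ _ _ s) (either-↑ʳ {length Lout} _ _ g))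
                                 (trans (E₁.coalesce-lr _ g)
                                   (trans (cong (λ v → if v then H zero (punchIn zero g) else false) (is-u₀ s))
                                     (sym (E₂.coalesce-lr s g))))
    ... | right g | left s   = trans (cong₂ E₁.C (either-↑ʳ {length Lout} _ _ g) (either-↑ˡ _ _ s))
                                 (trans (E₁.coalesce-rl g _)
                                   (trans (cong (λ v → if v then H (punchIn zero g) zero else false) (is-u₀ s))
                                     (sym (E₂.coalesce-rl g s))))
    ... | right g | right g' = trans (cong₂ E₁.C (either-↑ʳ {length Lout} _ _ g) (either-↑ʳ {length Lout} _ _ g'))
                                 (trans (E₁.coalesce-rr g g') (sym (E₂.coalesce-rr g g')))

  charPoly-Tout-deleteVertex : charPoly (deleteVertex Tout ũ) x ≡ charPoly Tin x
  charPoly-Tout-deleteVertex = viaList Lout refl ũ lookup-ũ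
    where
    viaList : ∀ (L : List (Fin n)) → L ≡ Lout → (w : Fin (length L)) → List.lookup L w ≡ u zero →
      charPoly (deleteVertex (induced T L) w) x ≡ charPoly Tin x
    viaList (y ∷ ys) L≡Lout w lookup-w =
      trans (charPoly-induced (induced T (y ∷ ys)) (punchIn w) _ (filterᵇ-allFin-≢ (length ys) w) x)
            (sym (charPoly-induced T (λ i → List.lookup (y ∷ ys) (punchIn w i)) _ kept-Tin x))
      where
      open ≡-Reasoning
      kept-Tin : filterᵇ (λ v → not ((true ∧ ⌊ u zero ≟ v ⌋) ∨ removedOut v)) (allFin n)
                 ≡ tabulate (λ i → List.lookup (y ∷ ys) (punchIn w i))
      kept-Tin = begin
          filterᵇ (λ v → not ((true ∧ ⌊ u zero ≟ v ⌋) ∨ removedOut v)) (allFin n)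
        ≡⟨ filterᵇ-cong _ (λ v → keepOut v ∧ not ⌊ v ≟ u zero ⌋)
             (λ v → trans (not-∨ ⌊ u zero ≟ v ⌋ (removedOut v))
               (cong (λ b → keepOut v ∧ not b) (⌊≟⌋-cong (u zero) v v (u zero) sym sym))) (allFin n) ⟩
          filterᵇ (λ v → keepOut v ∧ not ⌊ v ≟ u zero ⌋) (allFin n)
        ≡⟨ sym (filterᵇ-filterᵇ (λ v → not ⌊ v ≟ u zero ⌋) keepOut (allFin n)) ⟩
          filterᵇ (λ v → not ⌊ v ≟ u zero ⌋) Lout
        ≡⟨ cong (filterᵇ (λ v → not ⌊ v ≟ u zero ⌋)) (sym L≡Lout) ⟩
          filterᵇ (λ v → not ⌊ v ≟ u zero ⌋) (y ∷ ys)
        ≡⟨ filterᵇ-cong _ _ (λ v → cong (λ t → not ⌊ v ≟ t ⌋) (sym lookup-w)) (y ∷ ys) ⟩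
          filterᵇ (λ v → not ⌊ v ≟ List.lookup (y ∷ ys) w ⌋) (y ∷ ys)
        ≡⟨ filterᵇ-≢-lookup y ys w (subst Unique (sym L≡Lout) unique-Lout) ⟩
          tabulate (λ i → List.lookup (y ∷ ys) (punchIn w i)) ∎

  charPoly-deleteImage-coalesce : charPoly (deleteImage T' u' I) x ≡
    charPoly Tout x * charPoly (deleteVertex (mkGraph (suc M) H) zero) x
    + charPoly Tin x * (charPoly (mkGraph (suc M) H) x - x * charPoly (deleteVertex (mkGraph (suc M) H) zero) x)
  charPoly-deleteImage-coalesce =
    trans charPoly-T'-deleteImage
      (trans (charPoly-coalesce Tout ũ H zero x (trans (cong₂ (adj T) lookup-ũ lookup-ũ) (T-loopless zero)) H-loopless)
        (cong (λ P → charPoly Tout x * charPoly (deleteVertex (mkGraph (suc M) H) zero) x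
                   + P * (charPoly (mkGraph (suc M) H) x - x * charPoly (deleteVertex (mkGraph (suc M) H) zero) x))
              charPoly-Tout-deleteVertex))

sumSubsets-cong : ∀ k (f g : Subset k → ℤ) → (∀ s → f s ≡ g s) → sumSubsets k f ≡ sumSubsets k g
sumSubsets-cong zero    f g f≗g = f≗g []
sumSubsets-cong (suc k) f g f≗g =
  cong₂ _+_ (sumSubsets-cong k _ _ (f≗g ∘ (outside ∷_))) (sumSubsets-cong k _ _ (f≗g ∘ (inside ∷_)))

sumSubsets-+ : ∀ k (f g : Subset k → ℤ) → sumSubsets k (λ s → f s + g s) ≡ sumSubsets k f + sumSubsets k g
sumSubsets-+ zero    f g = refl
sumSubsets-+ (suc k) f g =
  trans (cong₂ _+_ (sumSubsets-+ k (f ∘ (outside ∷_)) (g ∘ (outside ∷_))) (sumSubsets-+ k (f ∘ (inside ∷_)) (g ∘ (inside ∷_))))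
        (interchange (sumSubsets k (f ∘ (outside ∷_))) (sumSubsets k (g ∘ (outside ∷_)))
                     (sumSubsets k (f ∘ (inside ∷_))) (sumSubsets k (g ∘ (inside ∷_))))
  where
  interchange : ∀ a b c d → a + b + (c + d) ≡ a + c + (b + d)
  interchange = solve-∀

subsetTerm : (k : ℕ) (T : Graph) (u : Fin k → Fin (size T)) (m : Fin k → ℕ) (G : (i : Fin k) → Adj (suc (m i)))
  (r : (i : Fin k) → Fin (suc (m i))) (a : Fin k → ℕ) (x : ℤ) → Subset k → ℤ
subsetTerm k T u m G r a x I =
  charPoly (deleteImage T u I) x
  * prodFin k (λ j → if lookup I j then + (a j) else + 1)
  * prodFin k (λ l → if lookup I l
                       then charPoly (mkGraph _ (G l)) x - x * charPoly (deleteVertex (mkGraph _ (G l)) (r l)) x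
                       else + 1)
  * prodFin k (λ j → charPoly (deleteVertex (mkGraph _ (G j)) (r j)) x ^ (a j ∸ (if lookup I j then 1 else 0)))

charPoly-multiCoalesce : ∀ k (T : Graph) (u : Fin k → Fin (size T)) → (∀ i j → u i ≡ u j → i ≡ j) →
  (∀ i → adj T (u i) (u i) ≡ false) →
  (m : Fin k → ℕ) (G : (i : Fin k) → Adj (suc (m i))) (r : (i : Fin k) → Fin (suc (m i))) →
  (∀ i → G i (r i) (r i) ≡ false) → (a : Fin k → ℕ) (x : ℤ) →
  charPoly (multiCoalesce k T u m G r a) x ≡ sumSubsets k (subsetTerm k T u m G r a x)
charPoly-multiCoalesce zero T u u-inj T-loopless m G r G-loopless a x =
  trans (sym (charPoly-induced T id _ (filterᵇ-all _ (allFin (size T)) (AllP.tabulate⁺ (λ _ → refl))) x))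
        (sym (*-identities (charPoly (deleteImage T u []) x)))
  where
  *-identities : ∀ P → P * + 1 * + 1 * + 1 ≡ P
  *-identities = solve-∀
charPoly-multiCoalesce (suc k) T u u-inj T-loopless m G r G-loopless a x =
  trans (charPoly-multiCoalesce k T' u' u'-inj T'-loopless (m ∘ suc) (G ∘ suc) (r ∘ suc) (G-loopless ∘ suc) (a ∘ suc) x)
    (trans (sumSubsets-cong k _ _ splitTerm)
      (sumSubsets-+ k (subsetTerm (suc k) T u m G r a x ∘ (outside ∷_)) (subsetTerm (suc k) T u m G r a x ∘ (inside ∷_))))
  where
  H₀ = rootedPower (G zero) (r zero) (a zero)
  module P = RootedPower (G zero) (r zero) (G-loopless zero) x
  H₀-loopless : H₀ zero zero ≡ false
  H₀-loopless = P.rootedPower-loopless (a zero)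
  module D = DeleteAfterCoalesce k T u u-inj T-loopless H₀ H₀-loopless x
  T' : Graph
  T' = mkGraph (size T ℕ.+ powSize (m zero) (a zero)) (coalesce (adj T) (u zero) H₀ zero)
  u' : Fin k → Fin (size T ℕ.+ powSize (m zero) (a zero))
  u' i = u (suc i) ↑ˡ powSize (m zero) (a zero)
  u'-inj : ∀ i j → u' i ≡ u' j → i ≡ j
  u'-inj i j eq = FP.suc-injective (u-inj (suc i) (suc j) (FP.↑ˡ-injective _ _ _ eq))
  T'-loopless : ∀ i → adj T' (u' i) (u' i) ≡ false
  T'-loopless i = trans (CoalesceEntries.coalesce-ll (adj T) (u zero) H₀ zero H₀-loopless (u (suc i)) (u (suc i)))
                        (T-loopless (suc i))
  distribute : ∀ Po Pi Rᵃ Rᵃ⁻¹ x Q a A B C → (Po * Rᵃ + Pi * ((x * Rᵃ + a * Q * Rᵃ⁻¹) - x * Rᵃ)) * A * B * C ≡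
    Po * (+ 1 * A) * (+ 1 * B) * (Rᵃ * C) + Pi * (a * A) * (Q * B) * (Rᵃ⁻¹ * C)
  distribute = solve-∀
  splitTerm : ∀ I → subsetTerm k T' u' (m ∘ suc) (G ∘ suc) (r ∘ suc) (a ∘ suc) x I ≡
    subsetTerm (suc k) T u m G r a x (outside ∷ I) + subsetTerm (suc k) T u m G r a x (inside ∷ I)
  splitTerm I =
    trans (cong (λ v → v * A * B * C)
            (trans (D.charPoly-deleteImage-coalesce I)
              (cong₂ (λ s t → Po * s + Pi * (t - x * s)) (P.charPoly-rootedPower-deleteRoot (a zero)) (P.charPoly-rootedPower (a zero)))))
      (distribute Po Pi (P.R ^ a zero) (P.R ^ (a zero ∸ 1)) x P.Q (+ a zero) A B C)
    where
    Po = charPoly (deleteImage T u (outside ∷ I)) x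
    Pi = charPoly (deleteImage T u (inside ∷ I)) x
    A = prodFin k (λ j → if lookup I j then + (a (suc j)) else + 1)
    B = prodFin k (λ l → if lookup I l
                           then charPoly (mkGraph _ (G (suc l))) x - x * charPoly (deleteVertex (mkGraph _ (G (suc l))) (r (suc l))) x
                           else + 1)
    C = prodFin k (λ j → charPoly (deleteVertex (mkGraph _ (G (suc j))) (r (suc j))) x ^ (a (suc j) ∸ (if lookup I j then 1 else 0)))

theorem1 : (k : ℕ) → 1 ≤ k →
    (T : Graph) → IsSimple (adj T) →
    (u : Fin k → Fin (size T)) → Injective _≡_ _≡_ u →
    (m : Fin k → ℕ) (G : (i : Fin k) → Adj (suc (m i))) → (∀ i → IsSimple (G i)) →
    (r : (i : Fin k) → Fin (suc (m i))) →
    (a : Fin k → ℕ) → (∀ i → 1 ≤ a i) →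
    (x : ℤ) →
    charPoly (multiCoalesce k T u m G r a) x
      ≡ sumSubsets k (λ I →
          charPoly (deleteImage T u I) x
          * prodFin k (λ j → if lookup I j then + (a j) else + 1)
          * prodFin k (λ l → if lookup I l
                               then charPoly (mkGraph _ (G l)) x
                                    - x * charPoly (deleteVertex (mkGraph _ (G l)) (r l)) x
                               else + 1)
          * prodFin k (λ j → charPoly (deleteVertex (mkGraph _ (G j)) (r j)) x
                               ^ (a j ∸ (if lookup I j then 1 else 0))))
theorem1 k _ T T-simple u u-inj m G G-simple r a _ x =
  charPoly-multiCoalesce k T u (λ i j → u-inj) (λ i → proj₂ T-simple (u i)) m G r (λ i → proj₂ (G-simple i) (r i)) a x
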